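{- Let $G=(V,E)$ be a finite simple undirected graph that is Eulerian, i.e. it has a closed trail traversing every edge exactly once, and run the one-pass streaming algorithm Euler-Tour (described in the context) on a stream of its edges. Then the written triples determine an Euler tour of $G$ in the following sense. The set $R^*(E)$ contains exactly one orientation of each edge of $E$, and $\delta^*$ is a well-defined map $R^*(E)\to R^*(E)$. Moreover, for every $e\in R^*(E)$, writing $x_{(1)}$ for the first node of a directed edge $x$, the node sequence $(e_{(1)},\delta^*(e)_{(1)},\ldots,(\delta^*)^{|E|}(e)_{(1)})$ is an Euler tour of the directed graph $(V,R^*(E))$. That is, the directed edges $e,\delta^*(e),\ldots,(\delta^*)^{|E|-1}(e)$ are pairwise distinct, they are exactly $R^*(E)$, and $(\delta^*)^{|E|}(e)=e$.
   Context: Setting: $G=(V,E)$ is a finite simple undirected graph with $n=|V|$. It is given as a stream of its edges, each read once in arbitrary order. RAM variables of Euler-Tour: - a counter $c$, initially $0$; - a set $F$ of directed edges, initially $\emptyset$; - a set $E_{\mathrm{int}}$ of undirected edges, initially $\emptyset$; - for each $v\in V$, values $j(v)\in V\cup\{0\}$ and $t(v)\in\mathbb{N}\cup\{0\}$, initially $0$. Output: triples $(v_1,v_2,s)$ of nodes with $\{v_1,v_2\}\in E$, meaning that the directed edge $(v_2,s)$ is marked as the successor of the directed edge $(v_1,v_2)$. Main loop: for each edge $e$ read from the stream, add $e$ to $E_{\mathrm{int}}$. If the graph $(V,E_{\mathrm{int}})$ now contains a cycle $C$, call Merge-Cycle$(C)$ with $C$ written as an ordered cycle $(v_1,\ldots,v_k)$.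 Indices are taken cyclically, so $v_0=v_k$ and $v_{k+1}=v_1$. The directed edges of $C$ are $(v_i,v_{i+1})$. Merge-Cycle performs the following steps in order. 1. For $i=1,\ldots,k$: if $t(v_i)=0$, set $j(v_i):=v_{i+1}$ and add $(v_{i-1},v_i)$ to $F$. 2. Set $M:=\emptyset$ and $J:=\emptyset$. For each $j=1,\ldots,|V|$: if some $v_i$ has $t(v_i)=j$, add exactly one such $v_i$ to $J$ and add $j$ to $M$. 3. For each $v_i\in J$: write $(v_{i-1},v_i,j(v_i))$, then set $j(v_i):=v_{i+1}$. 4. For each edge $(v_i,v_{i+1})$ of $C$ that has been neither written nor added to $F$: write $(v_i,v_{i+1},v_{i+2})$. 5. If $M=\emptyset$, set $c:=c+1$ and $a:=c$; otherwise set $a:=\min M$. For each $v\in V$ with $t(v)\in M$, set $t(v):=a$. For $i=1,\ldots,k$, set $t(v_i):=a$. 6. Delete the edges of $C$ from $E_{\mathrm{int}}$. After the stream ends: - If $E_{\mathrm{int}}\neq\emptyset$, an error "odd degree node" is reported. - If there are nodes with $t(u)\ne t(v)\ne 0$, an error "not connected" is reported. - Finally, for each $(u,v)\in F$, the triple $(u,v,j(v))$ is written. Definitions used in the claim: $R^*(E)$ is the set of directed edges $(u,v)$ for which some triple $(u,v,s)$ was written. $\delta^*$ is given by $\delta^*((v_1,v_2))=(v_2,s)$ for each written triple $(v_1,v_2,s)$. An Euler tour of a directed graph $(V,A)$ is a node sequence $(w_0,\ldots,w_m)$ with $w_0=w_m$ such that the directed edges $(w_{i-1},w_i)$, $i\in[m]$,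 are pairwise distinct, belong to $A$, and together are all of $A$. -}

module Defs where

open import Data.Nat as ℕ using (ℕ; zero; suc; _≤_; _⊓_; _+_)
open import Data.Nat.DivMod using (_%_; m%n<n)
open import Data.Fin using (Fin; toℕ; fromℕ<) renaming (_≟_ to _≟ᶠ_)
open import Data.Fin.Properties using () renaming (any? to anyFin?)
open import Data.Product using (Σ; ∃; _×_; _,_; proj₁; proj₂)
open import Data.Product.Properties using (≡-dec)
open import Data.Sum using (_⊎_; inj₁; inj₂)
open import Data.Maybe using (Maybe; just; nothing)
open import Data.Bool using (Bool; if_then_else_; _∨_)
open import Data.List using (List; []; _∷_; _++_; map; foldr; filter; allFin; zip)
open import Data.List.Relation.Unary.Any using (Any) renaming (any? to anyL?)
open import Data.List.Relation.Unary.All using (All)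
open import Data.List.Relation.Unary.AllPairs using (AllPairs)
open import Data.List.Relation.Unary.Unique.Propositional using (Unique)
open import Data.List.Membership.Propositional using (_∈_)
open import Relation.Nullary using (¬_; Dec; yes; no; does; ¬?)
open import Relation.Nullary.Decidable using (_×-dec_; _⊎-dec_)
open import Relation.Binary.PropositionalEquality using (_≡_; _≢_)
open import Function.Definitions using (Injective)

-- Nodes are Fin n; directed edges / stream entries are ordered pairs.

Edge : ℕ → Set
Edge n = Fin n × Fin n

-- A written triple (v₁ , v₂ , s); s ∈ V ∪ {0}, with 0 rendered as nothing.
Triple : ℕ → Set
Triple n = Fin n × Fin n × Maybe (Fin n)

_≟e_ : ∀ {n} (x y : Edge n) → Dec (x ≡ y)
_≟e_ = ≡-dec _≟ᶠ_ _≟ᶠ_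

SameEdge : ∀ {n} → Edge n → Edge n → Set
SameEdge (a , b) (c , d) = (a ≡ c × b ≡ d) ⊎ (a ≡ d × b ≡ c)

sameEdge? : ∀ {n} (x y : Edge n) → Dec (SameEdge x y)
sameEdge? (a , b) (c , d) = ((a ≟ᶠ c) ×-dec (b ≟ᶠ d)) ⊎-dec ((a ≟ᶠ d) ×-dec (b ≟ᶠ c))

_∈ᵤ_ : ∀ {n} → Edge n → List (Edge n) → Set
x ∈ᵤ L = Any (SameEdge x) L

_∈ᵤ?_ : ∀ {n} (x : Edge n) (L : List (Edge n)) → Dec (x ∈ᵤ L)
x ∈ᵤ? L = anyL? (sameEdge? x) L

_∈e?_ : ∀ {n} (x : Edge n) (L : List (Edge n)) → Dec (x ∈ L)
x ∈e? L = anyL? (x ≟e_) L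

swap : ∀ {n} → Edge n → Edge n
swap (a , b) = (b , a)

nxt : ∀ {m} → Fin (suc m) → Fin (suc m)
nxt {m} i = fromℕ< (m%n<n (suc (toℕ i)) (suc m))

prv : ∀ {m} → Fin (suc m) → Fin (suc m)
prv {m} i = fromℕ< (m%n<n (toℕ i + m) (suc m))

-- A cycle (v₁,…,v_k), k = suc m ≥ 3, of distinct nodes in the graph with
-- (undirected) edge list L, consecutive nodes (cyclically) adjacent.
Cycle : ∀ {n} → List (Edge n) → Set
Cycle {n} L = Σ ℕ λ m → Σ (Fin (suc m) → Fin n) λ C →
  (2 ≤ m) × Injective _≡_ _≡_ C × (∀ i → (C i , C (nxt i)) ∈ᵤ L)

-- RAM state of Euler-Tour, together with the list of written triples

record State (n : ℕ) : Set where
  constructor mkState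
  field
    c    : ℕ
    F    : List (Edge n)
    Eint : List (Edge n)
    j    : Fin n → Maybe (Fin n)
    t    : Fin n → ℕ
    out  : List (Triple n)
open State public

initState : ∀ {n} → State n
initState = mkState 0 [] [] (λ _ → nothing) (λ _ → 0) []

upd : ∀ {n} {A : Set} → (Fin n → A) → Fin n → A → (Fin n → A)
upd f v a w = if does (w ≟ᶠ v) then a else f w

newCA : ℕ → List ℕ → ℕ × ℕ
newCA c [] = suc c , suc c
newCA c (x ∷ xs) = c , foldr _⊓_ x xs

-- Admissible choices in step 2: Js is the list of indices i with v_i ∈ J.
ValidJ : ∀ {n m} → (Fin n → ℕ) → (Fin (suc m) → Fin n) → List (Fin (suc m)) → Set
ValidJ {n} t C Js =
  All (λ i → 1 ≤ t (C i) × t (C i) ≤ n) Js ×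
  AllPairs (λ i i′ → t (C i) ≢ t (C i′)) Js ×
  (∀ i → 1 ≤ t (C i) → t (C i) ≤ n → Any (λ i′ → t (C i′) ≡ t (C i)) Js)

mergeCycle : ∀ {n} → State n → (m : ℕ) → (Fin (suc m) → Fin n) → List (Fin (suc m)) → State n
mergeCycle {n} s m C Js = mkState c′ F₁ Eint′ j₂ t′ out₄
  where
  k = suc m
  isZ : ∀ i → Dec (t s (C i) ≡ 0)
  isZ i = t s (C i) ℕ.≟ 0
  j₁ : Fin n → Maybe (Fin n)
  j₁ = foldr (λ i f → if does (isZ i) then upd f (C i) (just (C (nxt i))) else f) (j s) (allFin k)
  F₁ : List (Edge n)
  F₁ = F s ++ map (λ i → (C (prv i) , C i)) (filter isZ (allFin k))
  out₃ : List (Triple n)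
  out₃ = out s ++ map (λ i → (C (prv i) , C i , j₁ (C i))) Js
  j₂ : Fin n → Maybe (Fin n)
  j₂ = foldr (λ i f → upd f (C i) (just (C (nxt i)))) j₁ Js
  written : List (Edge n)
  written = map (λ { (a , b , _) → (a , b) }) out₃
  cand : Fin k → Edge n
  cand i = (C i , C (nxt i))
  fresh : ∀ i → Dec (¬ (cand i ∈ written) × ¬ (cand i ∈ F₁))
  fresh i = ¬? (cand i ∈e? written) ×-dec ¬? (cand i ∈e? F₁)
  out₄ : List (Triple n)
  out₄ = out₃ ++ map (λ i → (C i , C (nxt i) , just (C (nxt (nxt i))))) (filter fresh (allFin k))
  M : List ℕ
  M = map (λ i → t s (C i)) Js
  c′ = proj₁ (newCA (c s) M)
  a = proj₂ (newCA (c s) M)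
  t′ : Fin n → ℕ
  t′ v = if does (anyFin? (λ i → C i ≟ᶠ v)) ∨ does (anyL? (t s v ℕ.≟_) M) then a else t s v
  Eint′ : List (Edge n)
  Eint′ = filter (λ x → ¬? (x ∈ᵤ? map cand (allFin k))) (Eint s)

-- Processing one stream edge (main loop body); nondeterministic in the
-- choice of the ordered cycle C and of J.
data Step {n : ℕ} : State n → Edge n → State n → Set where
  no-cycle : ∀ {s e} → ¬ Cycle (e ∷ Eint s) →
             Step s e (record s { Eint = e ∷ Eint s })
  merge    : ∀ {s e} (m : ℕ) (C : Fin (suc m) → Fin n) (Js : List (Fin (suc m))) →
             (2 ≤ m) → Injective _≡_ _≡_ C → (∀ i → (C i , C (nxt i)) ∈ᵤ (e ∷ Eint s)) →
             ValidJ (t s) C Js →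
             Step s e (mergeCycle (record s { Eint = e ∷ Eint s }) m C Js)

data Run {n : ℕ} : State n → List (Edge n) → State n → Set where
  done : ∀ {s} → Run s [] s
  step : ∀ {s e s′ es s″} → Step s e s′ → Run s′ es s″ → Run s (e ∷ es) s″

-- all triples written, including those of the final phase
output : ∀ {n} → State n → List (Triple n)
output s = out s ++ map (λ { (u , v) → (u , v , j s v) }) (F s)

RStar : ∀ {n} → List (Triple n) → Edge n → Set
RStar {n} T (u , v) = Σ (Maybe (Fin n)) λ s → (u , v , s) ∈ T

stepsOf : ∀ {n} → Fin n → List (Fin n) → List (Edge n)
stepsOf w₀ ws = zip (w₀ ∷ ws) ws

lastOf : ∀ {n} → Fin n → List (Fin n) → Fin n
lastOf w [] = w
lastOf _ (w ∷ ws) = lastOf w ws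

-- The stream S encodes a finite simple graph: no loops, each undirected
-- edge listed exactly once (in some orientation).
SimpleStream : ∀ {n} → List (Edge n) → Set
SimpleStream S = All (λ x → proj₁ x ≢ proj₂ x) S × AllPairs (λ x y → ¬ SameEdge x y) S

EulerianTrail : ∀ {n} → List (Edge n) → Fin n → List (Fin n) → Set
EulerianTrail S w₀ ws =
  lastOf w₀ ws ≡ w₀ ×
  AllPairs (λ x y → ¬ SameEdge x y) (stepsOf w₀ ws) ×
  All (λ x → x ∈ᵤ S) (stepsOf w₀ ws) ×
  (∀ x → x ∈ S → x ∈ᵤ stepsOf w₀ ws)

Eulerian : ∀ {n} → List (Edge n) → Set
Eulerian {n} S = Σ (Fin n) λ w₀ → Σ (List (Fin n)) λ ws → EulerianTrail S w₀ ws

IsEulerTour : ∀ {n} → (Edge n → Set) → Fin n → List (Fin n) → Set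
IsEulerTour A w₀ ws =
  lastOf w₀ ws ≡ w₀ ×
  Unique (stepsOf w₀ ws) ×
  All A (stepsOf w₀ ws) ×
  (∀ x → A x → x ∈ stepsOf w₀ ws)

iter : ∀ {A : Set} → (A → A) → ℕ → A → A
iter f zero x = x
iter f (suc k) x = f (iter f k x)

module Submission where

-- Two invariants are carried along the run.  The first is about the triples:
-- some successor map δ agrees with every triple written so far (including the
-- triples the final phase would write now), the written edges R* are closed
-- under δ, and any two of them ending in nodes of equal label t lie on one
-- δ-cycle.  Merge-Cycle keeps this true because its new successor map splices
-- the cycle C into the δ-cycles of the labels it merges (the set M), which all
-- receive the label a.  The second invariant is about edges: every read edge
-- is oriented exactly once in R* or still lies in E_int, E_int is acyclic, and
-- E_int together with the unread edges has only even degrees, because removing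
-- a cycle changes each degree by 0 or 2.  At the end E_int is an acyclic graph
-- of even degrees, hence empty, so R* orients E.  As E is traversed by one
-- trail, all its nodes carry the same label, so R* is a single δ-cycle; its
-- length is |E| by counting.

open import Defs
open import Data.Nat as ℕ using (ℕ; NonZero; zero; suc; _≤_; _<_; z≤n; s≤s; s≤s⁻¹; _+_; _*_; _∸_; _⊓_)
open import Data.Nat.Properties
open import Data.Nat.DivMod using (_%_; _/_; m%n<n; m%n%n≡m%n; m≡m%n+[m/n]*n; %-distribˡ-+; [m+n]%n≡m%n; m<n⇒m%n≡m; n%n≡0)
open import Data.Nat.Divisibility using (_∣_; divides; ∣m+n∣m⇒∣n; ∣⇒≤; _∣0; ∣-refl)
open import Data.Nat.Induction using (<-rec)
open import Data.Nat.Solver using (module +-*-Solver)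
open import Data.Fin as Fin using (Fin; toℕ; fromℕ<) renaming (_≟_ to _≟ᶠ_)
open import Data.Fin.Properties using (toℕ-fromℕ<; toℕ-injective; toℕ<n; pigeonhole) renaming (any? to anyFin?)
open import Data.Product using (Σ; ∃; _×_; _,_; proj₁; proj₂)
open import Data.Sum using (_⊎_; inj₁; inj₂)
open import Data.Maybe using (Maybe; just; fromMaybe)
open import Data.Bool using (Bool; true; false; if_then_else_; _∨_; T)
open import Data.Empty using (⊥-elim)
open import Data.List using (List; []; _∷_; _++_; map; foldr; filter; allFin; length; upTo; applyUpTo)
import Data.List.Properties as List
open import Data.List.Relation.Unary.Any as Any using (Any; here; there)
import Data.List.Relation.Unary.Any.Properties as Any
open import Data.List.Relation.Unary.All as All using (All; []; _∷_)
import Data.List.Relation.Unary.All.Properties as All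
open import Data.List.Relation.Unary.AllPairs as AllPairs using (AllPairs; []; _∷_)
import Data.List.Relation.Unary.AllPairs.Properties as AllPairs
open import Data.List.Relation.Unary.Unique.Propositional using (Unique)
import Data.List.Relation.Unary.Unique.Propositional.Properties as Unique
open import Data.List.Membership.Propositional using (_∈_; find; lose)
open import Data.List.Membership.Propositional.Properties
open import Relation.Nullary using (¬_; Dec; yes; no; does; ¬?)
open import Relation.Nullary.Decidable using (dec-true; dec-false; decidable-stable; _×-dec_; _⊎-dec_)
open import Relation.Unary using (Decidable)
open import Relation.Binary.PropositionalEquality
open import Function.Definitions using (Injective)

module _ {A : Set} {_~_ : A → A → Set}
         (~-sym : ∀ {x y} → x ~ y → y ~ x) (~-trans : ∀ {x y z} → x ~ y → y ~ z → x ~ z) where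

  private
    remove : (ys : List A) {x : A} → Any (x ~_) ys → List A
    remove (y ∷ ys) (here _) = ys
    remove (y ∷ ys) (there p) = y ∷ remove ys p

    length-remove : ∀ ys {x} (p : Any (x ~_) ys) → length ys ≡ suc (length (remove ys p))
    length-remove (y ∷ ys) (here _) = refl
    length-remove (y ∷ ys) (there p) = cong suc (length-remove ys p)

    remove-keeps : ∀ ys {x z} (p : Any (x ~_) ys) → ¬ z ~ x → Any (z ~_) ys → Any (z ~_) (remove ys p)
    remove-keeps (y ∷ ys) (here x~y) z≁x (here z~y) = ⊥-elim (z≁x (~-trans z~y (~-sym x~y)))
    remove-keeps (y ∷ ys) (here x~y) z≁x (there q) = q
    remove-keeps (y ∷ ys) (there p) z≁x (here z~y) = here z~y
    remove-keeps (y ∷ ys) (there p) z≁x (there q) = there (remove-keeps ys p z≁x q)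

  length-≤-of-distinct-cover : ∀ xs ys → AllPairs (λ x y → ¬ x ~ y) xs →
                               (∀ {x} → x ∈ xs → Any (x ~_) ys) → length xs ≤ length ys
  length-≤-of-distinct-cover [] ys _ _ = z≤n
  length-≤-of-distinct-cover (x ∷ xs) ys (x≁xs ∷ xs-distinct) cover
    with p ← cover (here refl) rewrite length-remove ys p =
    s≤s (length-≤-of-distinct-cover xs (remove ys p) xs-distinct
          (λ z∈xs → remove-keeps ys p (λ z~x → All.lookup x≁xs z∈xs (~-sym z~x)) (cover (there z∈xs))))

length-≤-of-unique-⊆ : ∀ {A : Set} (xs ys : List A) → Unique xs → (∀ {x} → x ∈ xs → x ∈ ys) → length xs ≤ length ys
length-≤-of-unique-⊆ = length-≤-of-distinct-cover sym trans

AllPairs-lookup : ∀ {A : Set} {P : A → A → Set} {xs : List A} {x y : A} →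
                  AllPairs P xs → x ∈ xs → y ∈ xs → x ≢ y → P x y ⊎ P y x
AllPairs-lookup (px ∷ _) (here refl) (here refl) x≢y = ⊥-elim (x≢y refl)
AllPairs-lookup (px ∷ _) (here refl) (there q) _ = inj₁ (All.lookup px q)
AllPairs-lookup (px ∷ _) (there p) (here refl) _ = inj₂ (All.lookup px p)
AllPairs-lookup (_ ∷ ap) (there p) (there q) x≢y = AllPairs-lookup ap p q x≢y

least-witness : ∀ {P : ℕ → Set} → Decidable P → ∀ {k} → P k → ∃ λ m → P m × (∀ q → q < m → ¬ P q)
least-witness {P} P? {k} = <-rec (λ k → P k → ∃ λ m → P m × (∀ q → q < m → ¬ P q)) search k
  where
  search : ∀ k → (∀ {q} → q < k → P q → ∃ λ m → P m × (∀ q → q < m → ¬ P q)) →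
           P k → ∃ λ m → P m × (∀ q → q < m → ¬ P q)
  search k below Pk with anyUpTo? P? k
  ... | yes (q , q<k , Pq) = below q<k Pq
  ... | no none = k , Pk , λ q q<k Pq → none (q , q<k , Pq)

module _ {A : Set} (δ : A → A) where

  iter-suc : ∀ k x → iter δ (suc k) x ≡ iter δ k (δ x)
  iter-suc zero x = refl
  iter-suc (suc k) x = cong δ (iter-suc k x)

  iter-+ : ∀ a b x → iter δ (a + b) x ≡ iter δ a (iter δ b x)
  iter-+ zero b x = refl
  iter-+ (suc a) b x = cong δ (iter-+ a b x)

  iter-* : ∀ {x} a p → iter δ p x ≡ x → iter δ (a * p) x ≡ x
  iter-* zero p per = refl
  iter-* {x} (suc a) p per = trans (iter-+ p (a * p) x) (trans (cong (iter δ p) (iter-* a p per)) per)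

  Reach : A → A → Set
  Reach x y = Σ ℕ λ k → iter δ k x ≡ y

module _ {A : Set} {δ : A → A} where

  reach-refl : ∀ {x} → Reach δ x x
  reach-refl = 0 , refl

  reach-step : ∀ {x y} → δ x ≡ y → Reach δ x y
  reach-step eq = 1 , eq

  reach-trans : ∀ {x y z} → Reach δ x y → Reach δ y z → Reach δ x z
  reach-trans {x} (a , p) (b , q) = b + a , trans (iter-+ δ b a x) (trans (cong (iter δ b) p) q)

iter-agree : ∀ {A : Set} (δ δ′ : A → A) x k → (∀ q → q < k → δ′ (iter δ q x) ≡ δ (iter δ q x)) →
             iter δ′ k x ≡ iter δ k x
iter-agree δ δ′ x zero _ = refl
iter-agree δ δ′ x (suc k) agree =
  trans (cong δ′ (iter-agree δ δ′ x k (λ q q<k → agree q (m<n⇒m<1+n q<k)))) (agree k (n<1+n k))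

reach-transfer : ∀ {A : Set} (δ δ′ : A → A) {x y} k → iter δ k x ≡ y →
                 (∀ q → q < k → δ′ (iter δ q x) ≡ δ (iter δ q x)) → Reach δ′ x y
reach-transfer δ δ′ {x} k reach agree = k , trans (iter-agree δ δ′ x k agree) reach

module MinimalReach {A : Set} (_≟_ : (a b : A) → Dec (a ≡ b)) (δ : A → A) where

  minimal-reach : ∀ {x y} → Reach δ x y → Σ ℕ λ k → iter δ k x ≡ y × (∀ q → q < k → iter δ q x ≢ y)
  minimal-reach {x} {y} (k , reach) = least-witness (λ k → iter δ k x ≟ y) {k} reach

  -- A visit to g before step k would give a shorter path to y, since z = δ g.
  minimal-reach-avoids : ∀ {g z y} k → δ g ≡ z → iter δ k z ≡ y → (∀ q → q < k → iter δ q z ≢ y) →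
                         ∀ q → q < k → iter δ q z ≢ g
  minimal-reach-avoids {g} {z} {y} k δg≡z reach minimal q q<k q-hits-g =
    minimal (k ∸ suc q) (∸-monoʳ-< {k} (s≤s z≤n) q<k) shortcut
    where
    loop : iter δ (suc q) z ≡ z
    loop = trans (cong δ q-hits-g) δg≡z
    shortcut : iter δ (k ∸ suc q) z ≡ y
    shortcut = begin
      iter δ (k ∸ suc q) z                      ≡⟨ cong (iter δ (k ∸ suc q)) loop ⟨
      iter δ (k ∸ suc q) (iter δ (suc q) z)     ≡⟨ iter-+ δ (k ∸ suc q) (suc q) z ⟨
      iter δ (k ∸ suc q + suc q) z              ≡⟨ cong (λ w → iter δ w z) (m∸n+n≡m q<k) ⟩
      iter δ k z                                ≡⟨ reach ⟩
      y                                         ∎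
      where open ≡-Reasoning

module Orbit {A : Set} (_≟_ : (a b : A) → Dec (a ≡ b)) (δ : A → A) {P : A → Set}
  (Ps : List A) (Ps-unique : Unique Ps) (∈Ps : ∀ {x} → P x → x ∈ Ps) (Ps⊆P : ∀ {x} → x ∈ Ps → P x)
  (closed : ∀ {x} → P x → P (δ x)) (connected : ∀ {x y} → P x → P y → Reach δ x y)
  {e : A} (Pe : P e) where

  open MinimalReach _≟_ δ

  orbit : ℕ → List A
  orbit k = applyUpTo (λ i → iter δ i e) k

  private
    P-iter : ∀ i → P (iter δ i e)
    P-iter zero = Pe
    P-iter (suc i) = closed (P-iter i)

    return : Σ ℕ λ k → iter δ k (δ e) ≡ e × (∀ q → q < k → iter δ q (δ e) ≢ e)
    return = minimal-reach (connected (closed Pe) Pe)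

    period : ℕ
    period = suc (proj₁ return)

    iter-period : iter δ period e ≡ e
    iter-period = trans (iter-suc δ (proj₁ return) e) (proj₁ (proj₂ return))

    period-minimal : ∀ q → 0 < q → q < period → iter δ q e ≢ e
    period-minimal (suc q) _ q<p eq = proj₂ (proj₂ return) q (s≤s⁻¹ q<p) (trans (sym (iter-suc δ q e)) eq)

    iter-mod-period : ∀ k → iter δ (k % period) e ≡ iter δ k e
    iter-mod-period k = sym (begin
      iter δ k e                                           ≡⟨ cong (λ w → iter δ w e) (m≡m%n+[m/n]*n k period) ⟩
      iter δ (k % period + k / period * period) e          ≡⟨ iter-+ δ (k % period) (k / period * period) e ⟩
      iter δ (k % period) (iter δ (k / period * period) e) ≡⟨ cong (iter δ (k % period)) (iter-* δ (k / period) period iter-period) ⟩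
      iter δ (k % period) e                                ∎)
      where open ≡-Reasoning

    -- Equal iterates i < j < period would give the shorter return time period ∸ j + i.
    iterates-distinct : ∀ {i j} → i < j → j < period → iter δ i e ≢ iter δ j e
    iterates-distinct {i} {j} i<j j<p eq = period-minimal (period ∸ j + i) positive shorter returns
      where
      positive : 0 < period ∸ j + i
      positive = ≤-trans (m<n⇒0<n∸m j<p) (m≤m+n (period ∸ j) i)
      shorter : period ∸ j + i < period
      shorter = ≤-trans (+-monoʳ-< (period ∸ j) i<j) (≤-reflexive (m∸n+n≡m (<⇒≤ j<p)))
      returns : iter δ (period ∸ j + i) e ≡ e
      returns = begin
        iter δ (period ∸ j + i) e              ≡⟨ iter-+ δ (period ∸ j) i e ⟩
        iter δ (period ∸ j) (iter δ i e)       ≡⟨ cong (iter δ (period ∸ j)) eq ⟩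
        iter δ (period ∸ j) (iter δ j e)       ≡⟨ iter-+ δ (period ∸ j) j e ⟨
        iter δ (period ∸ j + j) e              ≡⟨ cong (λ w → iter δ w e) (m∸n+n≡m (<⇒≤ j<p)) ⟩
        iter δ period e                        ≡⟨ iter-period ⟩
        e                                      ∎
        where open ≡-Reasoning

    orbit-period-unique : Unique (orbit period)
    orbit-period-unique = AllPairs.applyUpTo⁺₁ _ period iterates-distinct

    orbit⊆P : ∀ k {x} → x ∈ orbit k → P x
    orbit⊆P k x∈ with i , _ , refl ← ∈-applyUpTo⁻ (λ i → iter δ i e) x∈ = P-iter i

    P⊆orbit-period : ∀ {x} → P x → x ∈ orbit period
    P⊆orbit-period Px with k , reach ← connected Pe Px =
      subst (_∈ orbit period) (trans (iter-mod-period k) reach) (∈-applyUpTo⁺ (λ i → iter δ i e) (m%n<n k period))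

    period≡length : period ≡ length Ps
    period≡length = ≤-antisym
      (subst (_≤ length Ps) length-orbit
        (length-≤-of-unique-⊆ (orbit period) Ps orbit-period-unique (λ x∈ → ∈Ps (orbit⊆P period x∈))))
      (subst (length Ps ≤_) length-orbit
        (length-≤-of-unique-⊆ Ps (orbit period) Ps-unique (λ x∈ → P⊆orbit-period (Ps⊆P x∈))))
      where
      length-orbit : length (orbit period) ≡ period
      length-orbit = List.length-applyUpTo (λ i → iter δ i e) period

  orbit-unique : Unique (orbit (length Ps))
  orbit-unique = subst (λ k → Unique (orbit k)) period≡length orbit-period-unique

  orbit-exact : ∀ x → (x ∈ orbit (length Ps) → P x) × (P x → x ∈ orbit (length Ps))
  orbit-exact x = orbit⊆P (length Ps) , λ Px → subst (λ k → x ∈ orbit k) period≡length (P⊆orbit-period Px)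

  orbit-closes : iter δ (length Ps) e ≡ e
  orbit-closes = subst (λ k → iter δ k e ≡ e) period≡length iter-period

open ≡-Reasoning

%-absorbʳ : ∀ a b k .{{_ : NonZero k}} → (a + b % k) % k ≡ (a + b) % k
%-absorbʳ a b k = begin
  (a + b % k) % k             ≡⟨ %-distribˡ-+ a (b % k) k ⟩
  (a % k + b % k % k) % k     ≡⟨ cong (λ z → (a % k + z) % k) (m%n%n≡m%n b k) ⟩
  (a % k + b % k) % k         ≡⟨ %-distribˡ-+ a b k ⟨
  (a + b) % k                 ∎

private
  shift-mod-nonfixed : ∀ {d x k} .{{_ : NonZero k}} → 0 < d → d < k → x < k → (d + x) % k ≢ x
  shift-mod-nonfixed {d} {x} {k} 0<d d<k x<k fixed with d + x <? k
  ... | yes d+x<k = <⇒≢ 0<d (sym (+-cancelʳ-≡ x d 0 (trans (sym (m<n⇒m%n≡m d+x<k)) fixed)))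
  ... | no d+x≮k = <⇒≢ d<k (+-cancelʳ-≡ x d k (begin
    d + x              ≡⟨ m∸n+n≡m k≤d+x ⟨
    d + x ∸ k + k      ≡⟨ cong (_+ k) wrapped ⟩
    x + k              ≡⟨ +-comm x k ⟩
    k + x              ∎))
    where
    k≤d+x : k ≤ d + x
    k≤d+x = ≮⇒≥ d+x≮k
    below : d + x ∸ k < k
    below = subst (d + x ∸ k <_) (m+n∸n≡m k k) (∸-monoˡ-< (+-mono-< d<k x<k) k≤d+x)
    wrapped : d + x ∸ k ≡ x
    wrapped = begin
      d + x ∸ k            ≡⟨ m<n⇒m%n≡m below ⟨
      (d + x ∸ k) % k      ≡⟨ [m+n]%n≡m%n (d + x ∸ k) k ⟨
      (d + x ∸ k + k) % k  ≡⟨ cong (_% k) (m∸n+n≡m k≤d+x) ⟩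
      (d + x) % k          ≡⟨ fixed ⟩
      x                    ∎

module _ {m : ℕ} where

  toℕ-nxt : (i : Fin (suc m)) → toℕ (nxt i) ≡ suc (toℕ i) % suc m
  toℕ-nxt i = toℕ-fromℕ< (m%n<n (suc (toℕ i)) (suc m))

  toℕ-nxt-< : (i : Fin (suc m)) → toℕ i < m → toℕ (nxt i) ≡ suc (toℕ i)
  toℕ-nxt-< i i<m = trans (toℕ-nxt i) (m<n⇒m%n≡m (s≤s i<m))

  toℕ-nxt-last : (i : Fin (suc m)) → toℕ i ≡ m → toℕ (nxt i) ≡ 0
  toℕ-nxt-last i i≡m = trans (toℕ-nxt i) (trans (cong (λ z → suc z % suc m) i≡m) (n%n≡0 (suc m)))

  toℕ-prv : (i : Fin (suc m)) → toℕ (prv i) ≡ (toℕ i + m) % suc m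
  toℕ-prv i = toℕ-fromℕ< (m%n<n (toℕ i + m) (suc m))

  toℕ-iter-nxt : ∀ d (i : Fin (suc m)) → toℕ (iter nxt d i) ≡ (d + toℕ i) % suc m
  toℕ-iter-nxt zero i = sym (m<n⇒m%n≡m (toℕ<n i))
  toℕ-iter-nxt (suc d) i = begin
    toℕ (nxt (iter nxt d i))        ≡⟨ toℕ-nxt (iter nxt d i) ⟩
    suc (toℕ (iter nxt d i)) % suc m ≡⟨ cong (λ z → suc z % suc m) (toℕ-iter-nxt d i) ⟩
    (1 + (d + toℕ i) % suc m) % suc m ≡⟨ %-absorbʳ 1 (d + toℕ i) (suc m) ⟩
    suc (d + toℕ i) % suc m          ∎

  private
    full-turn : (i : Fin (suc m)) → (toℕ i + suc m) % suc m ≡ toℕ i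
    full-turn i = trans ([m+n]%n≡m%n (toℕ i) (suc m)) (m<n⇒m%n≡m (toℕ<n i))

  nxt-prv : (i : Fin (suc m)) → nxt (prv i) ≡ i
  nxt-prv i = toℕ-injective (begin
    toℕ (nxt (prv i))                  ≡⟨ toℕ-nxt (prv i) ⟩
    (1 + toℕ (prv i)) % suc m          ≡⟨ cong (λ z → (1 + z) % suc m) (toℕ-prv i) ⟩
    (1 + (toℕ i + m) % suc m) % suc m  ≡⟨ %-absorbʳ 1 (toℕ i + m) (suc m) ⟩
    (1 + (toℕ i + m)) % suc m          ≡⟨ cong (_% suc m) (sym (+-suc (toℕ i) m)) ⟩
    (toℕ i + suc m) % suc m            ≡⟨ full-turn i ⟩
    toℕ i                              ∎)

  prv-nxt : (i : Fin (suc m)) → prv (nxt i) ≡ i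
  prv-nxt i = toℕ-injective (begin
    toℕ (prv (nxt i))                  ≡⟨ toℕ-prv (nxt i) ⟩
    (toℕ (nxt i) + m) % suc m          ≡⟨ cong (λ z → (z + m) % suc m) (toℕ-nxt i) ⟩
    (suc (toℕ i) % suc m + m) % suc m  ≡⟨ cong (_% suc m) (+-comm (suc (toℕ i) % suc m) m) ⟩
    (m + suc (toℕ i) % suc m) % suc m  ≡⟨ %-absorbʳ m (suc (toℕ i)) (suc m) ⟩
    (m + suc (toℕ i)) % suc m          ≡⟨ cong (_% suc m) (trans (+-suc m (toℕ i)) (cong suc (+-comm m (toℕ i)))) ⟩
    (suc (toℕ i + m)) % suc m          ≡⟨ cong (_% suc m) (sym (+-suc (toℕ i) m)) ⟩
    (toℕ i + suc m) % suc m            ≡⟨ full-turn i ⟩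
    toℕ i                              ∎)

  nxt-reaches : (i j : Fin (suc m)) → Reach nxt i j
  nxt-reaches i j = toℕ j + (suc m ∸ toℕ i) , toℕ-injective (begin
    toℕ (iter nxt (toℕ j + (suc m ∸ toℕ i)) i)   ≡⟨ toℕ-iter-nxt (toℕ j + (suc m ∸ toℕ i)) i ⟩
    (toℕ j + (suc m ∸ toℕ i) + toℕ i) % suc m    ≡⟨ cong (_% suc m) (+-assoc (toℕ j) _ (toℕ i)) ⟩
    (toℕ j + (suc m ∸ toℕ i + toℕ i)) % suc m    ≡⟨ cong (λ z → (toℕ j + z) % suc m) (m∸n+n≡m (<⇒≤ (toℕ<n i))) ⟩
    (toℕ j + suc m) % suc m                      ≡⟨ full-turn j ⟩
    toℕ j                                        ∎)

  iter-nxt-irreflexive : ∀ {d} → 0 < d → d < suc m → (i : Fin (suc m)) → iter nxt d i ≢ i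
  iter-nxt-irreflexive {d} 0<d d<k i eq =
    shift-mod-nonfixed 0<d d<k (toℕ<n i) (trans (sym (toℕ-iter-nxt d i)) (cong toℕ eq))

  nxt-irreflexive : 1 ≤ m → (i : Fin (suc m)) → nxt i ≢ i
  nxt-irreflexive 1≤m = iter-nxt-irreflexive (s≤s z≤n) (s≤s 1≤m)

  nxt²-irreflexive : 2 ≤ m → (i : Fin (suc m)) → nxt (nxt i) ≢ i
  nxt²-irreflexive 2≤m = iter-nxt-irreflexive (s≤s z≤n) (s≤s 2≤m)

module _ {A : Set} {P : A → Set} (P? : Decidable P) where

  length-filter-∷ : ∀ x xs → length (filter P? (x ∷ xs)) ≡ length (filter P? (x ∷ [])) + length (filter P? xs)
  length-filter-∷ x xs with P? x
  ... | yes _ = refl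
  ... | no _ = refl

  length-filter-split : ∀ {Q : A → Set} (Q? : Decidable Q) xs → length (filter P? xs) ≡
    length (filter P? (filter Q? xs)) + length (filter P? (filter (λ x → ¬? (Q? x)) xs))
  length-filter-split Q? [] = refl
  length-filter-split Q? (x ∷ xs) with Q? x
  ... | yes _ with P? x
  ...   | yes _ = cong suc (length-filter-split Q? xs)
  ...   | no _ = length-filter-split Q? xs
  length-filter-split Q? (x ∷ xs) | no _ with P? x
  ...   | yes _ = trans (cong suc (length-filter-split Q? xs)) (sym (+-suc _ _))
  ...   | no _ = length-filter-split Q? xs

module _ {n : ℕ} where

  sameEdge-refl : ∀ {x : Edge n} → SameEdge x x
  sameEdge-refl = inj₁ (refl , refl)

  sameEdge-sym : ∀ {x y : Edge n} → SameEdge x y → SameEdge y x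
  sameEdge-sym (inj₁ (refl , refl)) = inj₁ (refl , refl)
  sameEdge-sym (inj₂ (refl , refl)) = inj₂ (refl , refl)

  sameEdge-trans : ∀ {x y z : Edge n} → SameEdge x y → SameEdge y z → SameEdge x z
  sameEdge-trans (inj₁ (refl , refl)) q = q
  sameEdge-trans (inj₂ (refl , refl)) (inj₁ (refl , refl)) = inj₂ (refl , refl)
  sameEdge-trans (inj₂ (refl , refl)) (inj₂ (refl , refl)) = inj₁ (refl , refl)

  sameEdge-swap : ∀ {x : Edge n} → SameEdge x (swap x)
  sameEdge-swap = inj₂ (refl , refl)

  ∈ᵤ-resp : ∀ {x y : Edge n} {L} → SameEdge x y → y ∈ᵤ L → x ∈ᵤ L
  ∈ᵤ-resp x~y = Any.map (sameEdge-trans x~y)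

  ∈⇒∈ᵤ : ∀ {x : Edge n} {L} → x ∈ L → x ∈ᵤ L
  ∈⇒∈ᵤ x∈ = lose x∈ sameEdge-refl

  Distinct : List (Edge n) → Set
  Distinct = AllPairs (λ x y → ¬ SameEdge x y)

  Loopless : Edge n → Set
  Loopless (a , b) = a ≢ b

  loopless-resp : ∀ {x y : Edge n} → SameEdge x y → Loopless y → Loopless x
  loopless-resp (inj₁ (refl , refl)) a≢b = a≢b
  loopless-resp (inj₂ (refl , refl)) a≢b = λ eq → a≢b (sym eq)

  Touches : Fin n → Edge n → Set
  Touches v (a , b) = a ≡ v ⊎ b ≡ v

  touches? : ∀ v → Decidable (Touches v)
  touches? v (a , b) = (a ≟ᶠ v) ⊎-dec (b ≟ᶠ v)

  touches-resp : ∀ {v} {x y : Edge n} → SameEdge x y → Touches v y → Touches v x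
  touches-resp (inj₁ (refl , refl)) t = t
  touches-resp (inj₂ (refl , refl)) (inj₁ e) = inj₂ e
  touches-resp (inj₂ (refl , refl)) (inj₂ e) = inj₁ e

  other-end : ∀ {h} (y : Edge n) → Touches h y → ∃ λ w → SameEdge (h , w) y
  other-end (a , b) (inj₁ refl) = b , inj₁ (refl , refl)
  other-end (a , b) (inj₂ refl) = a , inj₂ (refl , refl)

  degree : Fin n → List (Edge n) → ℕ
  degree v L = length (filter (touches? v) L)

  occurrences : Fin n → List (Fin n) → ℕ
  occurrences v ws = length (filter (_≟ᶠ v) ws)

  module _ {P : Edge n → Set} (P? : Decidable P) (P-resp : ∀ {x y} → SameEdge x y → P y → P x) where

    length-filter-≤-of-cover : ∀ {L₁ L₂ : List (Edge n)} → Distinct L₁ → (∀ {x} → x ∈ L₁ → x ∈ᵤ L₂) →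
                               length (filter P? L₁) ≤ length (filter P? L₂)
    length-filter-≤-of-cover {L₁} {L₂} distinct cover =
      length-≤-of-distinct-cover sameEdge-sym sameEdge-trans (filter P? L₁) (filter P? L₂)
        (AllPairs.filter⁺ P? distinct) covered
      where
      open import Data.List.Membership.Propositional.Properties using (∈-filter⁻; ∈-filter⁺)
      covered : ∀ {x} → x ∈ filter P? L₁ → x ∈ᵤ filter P? L₂
      covered {x} x∈ with x∈L₁ , Px ← ∈-filter⁻ P? {xs = L₁} x∈ with y , y∈L₂ , x~y ← find (cover x∈L₁) =
        ∈ᵤ-resp x~y (∈⇒∈ᵤ (∈-filter⁺ P? y∈L₂ (P-resp (sameEdge-sym x~y) Px)))

  degree-≡-of-same-edges : ∀ v {L₁ L₂ : List (Edge n)} → Distinct L₁ → Distinct L₂ →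
                           (∀ {x} → x ∈ L₁ → x ∈ᵤ L₂) → (∀ {x} → x ∈ L₂ → x ∈ᵤ L₁) → degree v L₁ ≡ degree v L₂
  degree-≡-of-same-edges v d₁ d₂ c₁ c₂ =
    ≤-antisym (length-filter-≤-of-cover (touches? v) touches-resp d₁ c₁)
              (length-filter-≤-of-cover (touches? v) touches-resp d₂ c₂)

  degree-edge : ∀ v {a b : Fin n} → a ≢ b →
                degree v ((a , b) ∷ []) ≡ occurrences v (a ∷ []) + occurrences v (b ∷ [])
  degree-edge v {a} {b} a≢b with a ≟ᶠ v | b ≟ᶠ v
  ... | yes refl | yes refl = ⊥-elim (a≢b refl)
  ... | yes _ | no _ = refl
  ... | no _ | yes _ = refl
  ... | no _ | no _ = refl

  -- Handshake lemma for a walk: every visit of v contributes two edge ends, except at the endpoints.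
  walk-degree : ∀ v w₀ ws → All Loopless (stepsOf w₀ ws) →
    occurrences v (w₀ ∷ []) + occurrences v (lastOf w₀ ws ∷ []) + degree v (stepsOf w₀ ws) ≡ 2 * occurrences v (w₀ ∷ ws)
  walk-degree v w₀ [] _ = solve 1 (λ a → a :+ a :+ con 0 := con 2 :* a) refl (occurrences v (w₀ ∷ []))
    where open +-*-Solver
  walk-degree v w₀ (w₁ ∷ ws) (w₀≢w₁ ∷ loopless) = begin
    a + l + degree v ((w₀ , w₁) ∷ stepsOf w₁ ws)        ≡⟨ cong (a + l +_) (length-filter-∷ (touches? v) (w₀ , w₁) (stepsOf w₁ ws)) ⟩
    a + l + (degree v ((w₀ , w₁) ∷ []) + d)             ≡⟨ cong (λ z → a + l + (z + d)) (degree-edge v w₀≢w₁) ⟩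
    a + l + ((a + b) + d)                               ≡⟨ solve 4 (λ a b l d → a :+ l :+ ((a :+ b) :+ d) := con 2 :* a :+ (b :+ l :+ d)) refl a b l d ⟩
    2 * a + (b + l + d)                                 ≡⟨ cong (2 * a +_) (walk-degree v w₁ ws loopless) ⟩
    2 * a + 2 * occurrences v (w₁ ∷ ws)                 ≡⟨ *-distribˡ-+ 2 a _ ⟨
    2 * (a + occurrences v (w₁ ∷ ws))                   ≡⟨ cong (2 *_) (length-filter-∷ (_≟ᶠ v) w₀ (w₁ ∷ ws)) ⟨
    2 * occurrences v (w₀ ∷ w₁ ∷ ws)                    ∎
    where
    open ≡-Reasoning
    open +-*-Solver
    a b l d : ℕ
    a = occurrences v (w₀ ∷ [])
    b = occurrences v (w₁ ∷ [])
    l = occurrences v (lastOf w₁ ws ∷ [])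
    d = degree v (stepsOf w₁ ws)

  eulerian⇒even-degree : ∀ (S : List (Edge n)) → SimpleStream S → Eulerian S → ∀ v → 2 ∣ degree v S
  eulerian⇒even-degree S (loopless , distinct) (w₀ , ws , closed , trail-distinct , trail⊆S , S⊆trail) v =
    subst (2 ∣_) (sym same-degree) (∣m+n∣m⇒∣n handshake (divides a (solve 1 (λ a → a :+ a := a :* con 2) refl a)))
    where
    open +-*-Solver
    a : ℕ
    a = occurrences v (w₀ ∷ [])
    trail-loopless : All Loopless (stepsOf w₀ ws)
    trail-loopless = All.map (λ x∈S → let _ , y∈S , x~y = find x∈S in loopless-resp x~y (All.lookup loopless y∈S)) trail⊆S
    handshake : 2 ∣ a + a + degree v (stepsOf w₀ ws)
    handshake = divides (occurrences v (w₀ ∷ ws)) (begin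
      a + a + degree v (stepsOf w₀ ws)                                 ≡⟨ cong (λ w → a + occurrences v (w ∷ []) + degree v (stepsOf w₀ ws)) closed ⟨
      a + occurrences v (lastOf w₀ ws ∷ []) + degree v (stepsOf w₀ ws) ≡⟨ walk-degree v w₀ ws trail-loopless ⟩
      2 * occurrences v (w₀ ∷ ws)                                      ≡⟨ *-comm 2 (occurrences v (w₀ ∷ ws)) ⟩
      occurrences v (w₀ ∷ ws) * 2                                      ∎)
      where open ≡-Reasoning
    same-degree : degree v S ≡ degree v (stepsOf w₀ ws)
    same-degree = degree-≡-of-same-edges v distinct trail-distinct (λ {x} x∈ → S⊆trail x x∈) (All.lookup trail⊆S)

-- Acyclic graphs of even degree are empty

-- At the end of a simple path another edge leaves (even degrees), so the path
-- grows until that edge returns to it, closing a cycle; this happens within n steps.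
module EvenDegreeCycle {n : ℕ} (E : List (Edge n)) (distinct : Distinct E) (loopless : All Loopless E)
                       (even : ∀ v → 2 ∣ degree v E) where

  record Path (r : ℕ) : Set where
    field
      node : ℕ → Fin n
      node-injective : ∀ a b → a ≤ r → b ≤ r → node a ≡ node b → a ≡ b
      edge : ∀ i → i < r → (node i , node (suc i)) ∈ᵤ E
  open Path

  path-shorter-than-n : ∀ {r} → Path r → r < n
  path-shorter-than-n {r} p with r <? n
  ... | yes r<n = r<n
  ... | no r≮n with i , j , i<j , same ← pigeonhole (≰⇒> r≮n) (λ i → node p (toℕ i)) =
    ⊥-elim (<⇒≢ i<j (node-injective p _ _ (s≤s⁻¹ (toℕ<n i)) (s≤s⁻¹ (toℕ<n j)) same))

  another-edge : ∀ h g → g ∈ᵤ E → Touches h g → ∃ λ y → y ∈ E × Touches h y × ¬ SameEdge y g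
  another-edge h g g∈E h-on-g with Any.any? (λ y → ¬? (sameEdge? y g)) (filter (touches? h) E)
  ... | yes found with y , y∈ , y≁g ← find found with y∈E , h-on-y ← ∈-filter⁻ (touches? h) {xs = E} y∈ =
    y , y∈E , h-on-y , y≁g
  ... | no none = ⊥-elim (<⇒≱ at-least-two at-most-one)
    where
    only-g : All (λ y → SameEdge y g) (filter (touches? h) E)
    only-g = All.map (decidable-stable (sameEdge? _ g)) (All.¬Any⇒All¬ _ none)
    at-most-one : degree h E ≤ 1
    at-most-one = length-≤-of-distinct-cover sameEdge-sym sameEdge-trans _ (g ∷ [])
                    (AllPairs.filter⁺ (touches? h) distinct) (λ y∈ → here (All.lookup only-g y∈))
    at-least-one : 1 ≤ degree h E
    at-least-one with y , y∈E , g~y ← find g∈E = ∈-length (∈-filter⁺ (touches? h) y∈E (touches-resp (sameEdge-sym g~y) h-on-g))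
    at-least-two : 1 < degree h E
    at-least-two with degree h E | even h | at-least-one
    ... | suc d | 2∣d+1 | _ = ∣⇒≤ 2∣d+1

  module Extend {r : ℕ} (p : Path (suc r)) where

    h : Fin n
    h = node p (suc r)

    next : Σ (Fin n) λ w → (h , w) ∈ᵤ E × w ≢ h × w ≢ node p r
    next with y , y∈E , h-on-y , y≁last ← another-edge h (node p r , h) (edge p r ≤-refl) (inj₂ refl) =
      continue y∈E y≁last (other-end y h-on-y)
      where
      continue : ∀ {y} → y ∈ E → ¬ SameEdge y (node p r , h) → (∃ λ w → SameEdge (h , w) y) →
                 Σ (Fin n) λ w → (h , w) ∈ᵤ E × w ≢ h × w ≢ node p r
      continue y∈E y≁last (w , hw~y) =
        w , ∈ᵤ-resp hw~y (∈⇒∈ᵤ y∈E) ,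
        (λ w≡h → loopless-resp hw~y (All.lookup loopless y∈E) (sym w≡h)) ,
        (λ { refl → y≁last (sameEdge-trans (sameEdge-sym hw~y) sameEdge-swap) })

    w : Fin n
    w = proj₁ next
    hw∈E : (h , w) ∈ᵤ E
    hw∈E = proj₁ (proj₂ next)
    w≢h : w ≢ h
    w≢h = proj₁ (proj₂ (proj₂ next))
    w≢last : w ≢ node p r
    w≢last = proj₂ (proj₂ (proj₂ next))

    close : ∀ q → q ≤ suc r → node p q ≡ w → Cycle E
    close q q≤ w-at-q = m , C , 2≤m , C-injective , C-edges
      where
      m : ℕ
      m = suc r ∸ q
      q+m≡ : q + m ≡ suc r
      q+m≡ = m+[n∸m]≡n q≤
      q<r : q < r
      q<r = ≤∧≢⇒< (s≤s⁻¹ (≤∧≢⇒< q≤ (λ { refl → w≢h (sym w-at-q) }))) (λ { refl → w≢last (sym w-at-q) })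
      2≤m : 2 ≤ m
      2≤m = m+n≤o⇒m≤o∸n 2 (s≤s q<r)
      C : Fin (suc m) → Fin n
      C i = node p (q + toℕ i)
      in-range : ∀ (i : Fin (suc m)) → q + toℕ i ≤ suc r
      in-range i = subst (q + toℕ i ≤_) q+m≡ (+-monoʳ-≤ q (s≤s⁻¹ (toℕ<n i)))
      C-injective : Injective _≡_ _≡_ C
      C-injective {i} {j} eq = toℕ-injective (+-cancelˡ-≡ q _ _ (node-injective p _ _ (in-range i) (in-range j) eq))
      C-edges : ∀ i → (C i , C (nxt i)) ∈ᵤ E
      C-edges i with m≤n⇒m<n∨m≡n (s≤s⁻¹ (toℕ<n i))
      ... | inj₁ i<m = subst (λ z → (C i , node p z) ∈ᵤ E) (sym (trans (cong (q +_) (toℕ-nxt-< i i<m)) (+-suc q (toℕ i))))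
                         (edge p (q + toℕ i) (subst (_≤ suc r) (+-suc q (toℕ i)) (subst (q + suc (toℕ i) ≤_) q+m≡ (+-monoʳ-≤ q i<m))))
      ... | inj₂ i≡m = subst₂ (λ a b → (a , b) ∈ᵤ E)
                         (cong (node p) (sym (trans (cong (q +_) i≡m) q+m≡)))
                         (trans (sym w-at-q) (cong (node p) (sym (trans (cong (q +_) (toℕ-nxt-last i i≡m)) (+-identityʳ q)))))
                         hw∈E

    extend : Cycle E ⊎ Path (suc (suc r))
    extend with anyFin? (λ (i : Fin (suc (suc r))) → node p (toℕ i) ≟ᶠ w)
    ... | yes (i , w-at-i) = inj₁ (close (toℕ i) (s≤s⁻¹ (toℕ<n i)) w-at-i)
    ... | no w-new = inj₂ record { node = node′ ; node-injective = node′-injective ; edge = edge′ }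
      where
      node′ : ℕ → Fin n
      node′ i with i ℕ.≟ suc (suc r)
      ... | yes _ = w
      ... | no _ = node p i
      node′-new : node′ (suc (suc r)) ≡ w
      node′-new with suc (suc r) ℕ.≟ suc (suc r)
      ... | yes _ = refl
      ... | no ne = ⊥-elim (ne refl)
      node′-old : ∀ i → i ≤ suc r → node′ i ≡ node p i
      node′-old i i≤ with i ℕ.≟ suc (suc r)
      ... | yes refl = ⊥-elim (1+n≰n i≤)
      ... | no _ = refl
      off-path : ∀ b → b ≤ suc r → node p b ≢ w
      off-path b b≤ eq = w-new (fromℕ< (s≤s b≤) , subst (λ z → node p z ≡ w) (sym (toℕ-fromℕ< (s≤s b≤))) eq)
      new-or-old : ∀ a → a ≤ suc (suc r) → a ≡ suc (suc r) ⊎ a ≤ suc r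
      new-or-old a a≤ with m≤n⇒m<n∨m≡n a≤
      ... | inj₁ a<r+2 = inj₂ (s≤s⁻¹ a<r+2)
      ... | inj₂ a≡r+2 = inj₁ a≡r+2
      node′-injective : ∀ a b → a ≤ suc (suc r) → b ≤ suc (suc r) → node′ a ≡ node′ b → a ≡ b
      node′-injective a b a≤ b≤ eq with new-or-old a a≤ | new-or-old b b≤
      ... | inj₁ a≡ | inj₁ b≡ = trans a≡ (sym b≡)
      ... | inj₁ refl | inj₂ b≤′ = ⊥-elim (off-path b b≤′ (trans (sym (node′-old b b≤′)) (trans (sym eq) node′-new)))
      ... | inj₂ a≤′ | inj₁ refl = ⊥-elim (off-path a a≤′ (trans (sym (node′-old a a≤′)) (trans eq node′-new)))
      ... | inj₂ a≤′ | inj₂ b≤′ = node-injective p a b a≤′ b≤′ (trans (sym (node′-old a a≤′)) (trans eq (node′-old b b≤′)))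
      edge′ : ∀ i → i < suc (suc r) → (node′ i , node′ (suc i)) ∈ᵤ E
      edge′ i i< with new-or-old (suc i) i<
      ... | inj₁ refl = subst₂ (λ a b → (a , b) ∈ᵤ E) (sym (node′-old (suc r) ≤-refl)) (sym node′-new) hw∈E
      ... | inj₂ i<r+1 = subst₂ (λ a b → (a , b) ∈ᵤ E) (sym (node′-old i (≤-trans (n≤1+n i) i<r+1)))
                           (sym (node′-old (suc i) i<r+1)) (edge p i i<r+1)

  grow : ∀ budget r → Path (suc r) → n ≤ suc r + budget → Cycle E
  grow zero r p n≤ = ⊥-elim (<⇒≱ (path-shorter-than-n p) (subst (n ≤_) (+-identityʳ _) n≤))
  grow (suc budget) r p n≤ with Extend.extend p
  ... | inj₁ cycle = cycle
  ... | inj₂ p′ = grow budget (suc r) p′ (subst (n ≤_) (+-suc (suc r) budget) n≤)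

  nonempty⇒cycle : ∀ {x xs} → E ≡ x ∷ xs → Cycle E
  nonempty⇒cycle {a , b} refl = grow n 0 single-edge (m≤n+m n 1)
    where
    a≢b : a ≢ b
    a≢b = All.lookup loopless (here refl)
    single-edge : Path 1
    single-edge = record
      { node = λ { zero → a ; (suc _) → b }
      ; node-injective = injective
      ; edge = λ { zero _ → here sameEdge-refl ; (suc _) (s≤s ()) } }
      where
      injective : ∀ x y → x ≤ 1 → y ≤ 1 → _ → x ≡ y
      injective zero zero _ _ _ = refl
      injective zero (suc zero) _ _ eq = ⊥-elim (a≢b eq)
      injective (suc zero) zero _ _ eq = ⊥-elim (a≢b (sym eq))
      injective (suc zero) (suc zero) _ _ _ = refl
      injective (suc (suc _)) _ (s≤s ()) _ _
      injective _ (suc (suc _)) _ (s≤s ()) _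

acyclic-even-degree⇒empty : ∀ {n} (E : List (Edge n)) → Distinct E → All Loopless E → (∀ v → 2 ∣ degree v E) →
                             ¬ Cycle E → E ≡ []
acyclic-even-degree⇒empty [] _ _ _ _ = refl
acyclic-even-degree⇒empty (x ∷ xs) distinct loopless even acyclic =
  ⊥-elim (acyclic (EvenDegreeCycle.nonempty⇒cycle (x ∷ xs) distinct loopless even refl))

module MergeCycle {n : ℕ} (s : State n) (m : ℕ) (C : Fin (suc m) → Fin n) (Js : List (Fin (suc m)))
                  (C-injective : Injective _≡_ _≡_ C) where

  k : ℕ
  k = suc m

  s′ : State n
  s′ = mergeCycle s m C Js

  M : List ℕ
  M = map (λ i → t s (C i)) Js

  a : ℕ
  a = proj₂ (newCA (c s) M)

  arc : Fin k → Edge n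
  arc i = (C i , C (nxt i))

  arc-prv : ∀ i → (C (prv i) , C i) ≡ arc (prv i)
  arc-prv i = cong (λ z → (C (prv i) , C z)) (sym (nxt-prv i))

  -- The successor updates of steps 1 and 3: j(v_i) := v_{i+1} for the selected indices.
  updates : (Fin k → Bool) → List (Fin k) → (Fin n → Maybe (Fin n)) → Fin n → Maybe (Fin n)
  updates b L g = foldr (λ i f → if b i then upd f (C i) (just (C (nxt i))) else f) g L

  updates-hit : ∀ b L g i → i ∈ L → b i ≡ true → updates b L g (C i) ≡ just (C (nxt i))
  updates-hit b (i′ ∷ L) g i i∈ bi with b i′ in bi′
  updates-hit b (i′ ∷ L) g i (here refl) bi | false with () ← trans (sym bi) bi′
  updates-hit b (i′ ∷ L) g i (there i∈) bi | false = updates-hit b L g i i∈ bi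
  ... | true with C i ≟ᶠ C i′
  ...   | yes eq = cong (λ z → just (C (nxt z))) (sym (C-injective eq))
  updates-hit b (i′ ∷ L) g i (here refl) bi | true | no ne = ⊥-elim (ne refl)
  updates-hit b (i′ ∷ L) g i (there i∈) bi | true | no _ = updates-hit b L g i i∈ bi

  updates-miss : ∀ b L g v → (∀ i → i ∈ L → b i ≡ true → C i ≢ v) → updates b L g v ≡ g v
  updates-miss b [] g v _ = refl
  updates-miss b (i′ ∷ L) g v avoid with b i′ in bi′
  ... | false = updates-miss b L g v (λ i i∈ → avoid i (there i∈))
  ... | true with v ≟ᶠ C i′
  ...   | yes eq = ⊥-elim (avoid i′ (here refl) bi′ (sym eq))
  ...   | no _ = updates-miss b L g v (λ i i∈ → avoid i (there i∈))

  unlabelled? : ∀ i → Dec (t s (C i) ≡ 0)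
  unlabelled? i = t s (C i) ℕ.≟ 0

  j₁ : Fin n → Maybe (Fin n)
  j₁ = updates (λ i → does (unlabelled? i)) (allFin k) (j s)

  j₁-unlabelled : ∀ i → t s (C i) ≡ 0 → j₁ (C i) ≡ just (C (nxt i))
  j₁-unlabelled i t≡0 = updates-hit (λ i → does (unlabelled? i)) (allFin k) (j s) i (∈-allFin i) (dec-true (unlabelled? i) t≡0)

  j₁-elsewhere : ∀ v → (∀ i → C i ≡ v → t s (C i) ≢ 0) → j₁ v ≡ j s v
  j₁-elsewhere v labelled = updates-miss (λ i → does (unlabelled? i)) (allFin k) (j s) v avoid
    where
    avoid : ∀ i → i ∈ allFin k → does (unlabelled? i) ≡ true → C i ≢ v
    avoid i _ d eq = labelled i eq (≡ᵇ⇒≡ (t s (C i)) 0 (subst T (sym d) _))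

  j′-on-J : ∀ i → i ∈ Js → j s′ (C i) ≡ just (C (nxt i))
  j′-on-J i i∈ = updates-hit (λ _ → true) Js j₁ i i∈ refl

  j′-unlabelled : ∀ i → t s (C i) ≡ 0 → j s′ (C i) ≡ just (C (nxt i))
  j′-unlabelled i t≡0 with Any.any? (i ≟ᶠ_) Js
  ... | yes i∈ = j′-on-J i i∈
  ... | no i∉ = trans (updates-miss (λ _ → true) Js j₁ (C i) (λ i′ i′∈ _ eq → i∉ (subst (_∈ Js) (C-injective eq) i′∈)))
                      (j₁-unlabelled i t≡0)

  j′-elsewhere : ∀ v → (∀ i → C i ≡ v → ¬ i ∈ Js × t s (C i) ≢ 0) → j s′ v ≡ j s v
  j′-elsewhere v off = trans (updates-miss (λ _ → true) Js j₁ v (λ i i∈ _ eq → proj₁ (off i eq) i∈))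
                             (j₁-elsewhere v (λ i eq → proj₂ (off i eq)))

  on-cycle? : ∀ v → Dec (∃ λ i → C i ≡ v)
  on-cycle? v = anyFin? (λ i → C i ≟ᶠ v)

  in-M? : ∀ v → Dec (t s v ∈ M)
  in-M? v = Any.any? (t s v ℕ.≟_) M

  private
    if-∨-true : ∀ {x : ℕ} b₁ b₂ → b₁ ≡ true ⊎ b₂ ≡ true → (if b₁ ∨ b₂ then a else x) ≡ a
    if-∨-true true _ _ = refl
    if-∨-true false true _ = refl
    if-∨-true false false (inj₁ ())
    if-∨-true false false (inj₂ ())

    if-∨-false : ∀ {x : ℕ} b₁ b₂ → b₁ ≡ false → b₂ ≡ false → (if b₁ ∨ b₂ then a else x) ≡ x
    if-∨-false false false _ _ = refl

  t′-on-cycle : ∀ i → t s′ (C i) ≡ a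
  t′-on-cycle i = if-∨-true (does (on-cycle? (C i))) _ (inj₁ (dec-true (on-cycle? (C i)) (i , refl)))

  t′-merged : ∀ v → t s v ∈ M → t s′ v ≡ a
  t′-merged v t∈M = if-∨-true (does (on-cycle? v)) (does (in-M? v)) (inj₂ (dec-true (in-M? v) t∈M))

  t′-elsewhere : ∀ v → (∀ i → C i ≢ v) → ¬ t s v ∈ M → t s′ v ≡ t s v
  t′-elsewhere v off t∉M =
    if-∨-false (does (on-cycle? v)) (does (in-M? v)) (dec-false (on-cycle? v) (λ (i , eq) → off i eq)) (dec-false (in-M? v) t∉M)

  module WithValidJ (valid : ValidJ (t s) C Js) where

    J-labelled : ∀ {i} → i ∈ Js → 1 ≤ t s (C i)
    J-labelled i∈ = proj₁ (All.lookup (proj₁ valid) i∈)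

    J-label≢0 : ∀ {i} → i ∈ Js → t s (C i) ≢ 0
    J-label≢0 i∈ t≡0 with () ← subst (1 ≤_) t≡0 (J-labelled i∈)

    j₁-on-J : ∀ i → i ∈ Js → j₁ (C i) ≡ j s (C i)
    j₁-on-J i i∈ = j₁-elsewhere (C i) (λ i′ eq → subst (λ q → t s (C q) ≢ 0) (sym (C-injective eq)) (J-label≢0 i∈))

    out₃ : List (Triple n)
    out₃ = out s ++ map (λ i → (C (prv i) , C i , j₁ (C i))) Js

    written : List (Edge n)
    written = map (λ { (a , b , _) → (a , b) }) out₃

    F₁ : List (Edge n)
    F₁ = F s ++ map (λ i → (C (prv i) , C i)) (filter unlabelled? (allFin k))

    fresh : ∀ i → Dec (¬ (arc i ∈ written) × ¬ (arc i ∈ F₁))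
    fresh i = ¬? (arc i ∈e? written) ×-dec ¬? (arc i ∈e? F₁)

    step4-triple : Fin k → Triple n
    step4-triple i = (C i , C (nxt i) , just (C (nxt (nxt i))))

    data NewOut (u v : Fin n) (r : Maybe (Fin n)) : Set where
      out-before : (u , v , r) ∈ out s → NewOut u v r
      out-at-J   : ∀ i → i ∈ Js → u ≡ C (prv i) → v ≡ C i → r ≡ j s (C i) → NewOut u v r
      out-step4  : ∀ i → ¬ nxt i ∈ Js → ¬ arc i ∈ F s′ → u ≡ C i → v ≡ C (nxt i) → r ≡ just (C (nxt (nxt i))) → NewOut u v r

    data NewOutput (u v : Fin n) (r : Maybe (Fin n)) : Set where
      written-out : NewOut u v r → NewOutput u v r
      final-old-F : (u , v) ∈ F s → r ≡ j s′ v → NewOutput u v r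
      final-new-F : ∀ i → t s (C i) ≡ 0 → u ≡ C (prv i) → v ≡ C i → r ≡ j s′ v → NewOutput u v r

    out-cases : ∀ {u v r} → (u , v , r) ∈ out s′ → NewOut u v r
    out-cases q with ∈-++⁻ out₃ q
    ... | inj₁ q₃ with ∈-++⁻ (out s) q₃
    ...   | inj₁ before = out-before before
    ...   | inj₂ at-J with i , i∈ , refl ← ∈-map⁻ _ at-J = out-at-J i i∈ refl refl (j₁-on-J i i∈)
    out-cases q | inj₂ q₄ with i , i∈ , refl ← ∈-map⁻ step4-triple q₄
                          with _ , (unwritten , ∉F₁) ← ∈-filter⁻ fresh {xs = allFin k} i∈ =
      out-step4 i next∉J ∉F₁ refl refl refl
      where
      next∉J : ¬ nxt i ∈ Js
      next∉J next∈ = unwritten (subst (λ z → (C z , C (nxt i)) ∈ written) (prv-nxt i)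
                       (∈-map⁺ _ (∈-++⁺ʳ (out s) (∈-map⁺ (λ i → (C (prv i) , C i , j₁ (C i))) next∈))))

    output-cases : ∀ {u v r} → (u , v , r) ∈ output s′ → NewOutput u v r
    output-cases p with ∈-++⁻ (out s′) p
    ... | inj₁ q = written-out (out-cases q)
    ... | inj₂ q with (u , v) , f∈ , refl ← ∈-map⁻ _ q with ∈-++⁻ (F s) f∈
    ...   | inj₁ old = final-old-F old refl
    ...   | inj₂ new with i , i∈ , refl ← ∈-map⁻ _ new =
      final-new-F i (proj₂ (∈-filter⁻ unlabelled? {xs = allFin k} i∈)) refl refl refl

    R′-cases : ∀ {x} → RStar (output s′) x → RStar (output s) x ⊎ ∃ λ i → x ≡ arc i
    R′-cases {u , v} (r , p) with output-cases p
    ... | written-out (out-before old) = inj₁ (r , ∈-++⁺ˡ old)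
    ... | written-out (out-at-J i _ refl refl _) = inj₂ (prv i , arc-prv i)
    ... | written-out (out-step4 i _ _ refl refl _) = inj₂ (i , refl)
    ... | final-old-F f _ = inj₁ (j s v , ∈-++⁺ʳ (out s) (∈-map⁺ _ f))
    ... | final-new-F i _ refl refl _ = inj₂ (prv i , arc-prv i)

    R′-old : ∀ {x} → RStar (output s) x → RStar (output s′) x
    R′-old {u , v} (r , p) with ∈-++⁻ (out s) p
    ... | inj₁ q = r , ∈-++⁺ˡ (∈-++⁺ˡ (∈-++⁺ˡ q))
    ... | inj₂ q with _ , f∈ , refl ← ∈-map⁻ _ q = j s′ v , ∈-++⁺ʳ (out s′) (∈-map⁺ _ (∈-++⁺ˡ f∈))

    R′-arc : (∀ i → ¬ RStar (output s) (arc i)) → ∀ i → RStar (output s′) (arc i)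
    R′-arc new i with Any.any? (nxt i ≟ᶠ_) Js
    ... | yes next∈ = j₁ (C (nxt i)) , ∈-++⁺ˡ (∈-++⁺ˡ (subst (λ z → (C z , C (nxt i) , j₁ (C (nxt i))) ∈ out₃) (prv-nxt i)
                        (∈-++⁺ʳ (out s) (∈-map⁺ (λ i → (C (prv i) , C i , j₁ (C i))) next∈))))
    ... | no next∉ with unlabelled? (nxt i)
    ...   | yes t≡0 = j s′ (C (nxt i)) , ∈-++⁺ʳ (out s′) (∈-map⁺ _ (subst (λ w → (C w , C (nxt i)) ∈ F₁) (prv-nxt i)
                        (∈-++⁺ʳ (F s) (∈-map⁺ (λ i → (C (prv i) , C i)) (∈-filter⁺ unlabelled? (∈-allFin (nxt i)) t≡0)))))
    ...   | no t≢0 = just (C (nxt (nxt i))) ,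
                     ∈-++⁺ˡ (∈-++⁺ʳ out₃ (∈-map⁺ step4-triple (∈-filter⁺ fresh (∈-allFin i) (unwritten , ∉F₁))))
      where
      unwritten : ¬ arc i ∈ written
      unwritten w with (_ , _ , r) , y∈ , eq ← ∈-map⁻ _ w with ∈-++⁻ (out s) y∈
      ... | inj₁ old = new i (r , subst (λ z → (proj₁ z , proj₂ z , r) ∈ output s) (sym eq) (∈-++⁺ˡ old))
      ... | inj₂ q with i′ , i′∈ , refl ← ∈-map⁻ _ q = next∉ (subst (_∈ Js) (sym (C-injective (cong proj₂ eq))) i′∈)
      ∉F₁ : ¬ arc i ∈ F₁
      ∉F₁ w with ∈-++⁻ (F s) w
      ... | inj₁ old = new i (j s (C (nxt i)) , ∈-++⁺ʳ (out s) (∈-map⁺ _ old))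
      ... | inj₂ q with i′ , i′∈ , eq ← ∈-map⁻ _ q =
        t≢0 (subst (λ z → t s (C z) ≡ 0) (sym (C-injective (cong proj₂ eq))) (proj₂ (∈-filter⁻ unlabelled? {xs = allFin k} i′∈)))

    F′-old : ∀ {x} → x ∈ F s → x ∈ F s′
    F′-old = ∈-++⁺ˡ

    F′-new : ∀ i → t s (C i) ≡ 0 → (C (prv i) , C i) ∈ F s′
    F′-new i t≡0 = ∈-++⁺ʳ (F s) (∈-map⁺ (λ i → (C (prv i) , C i)) (∈-filter⁺ unlabelled? (∈-allFin i) t≡0))

    F′-cases : ∀ {x} → x ∈ F s′ → x ∈ F s ⊎ ∃ λ i → t s (C i) ≡ 0 × x ≡ (C (prv i) , C i)
    F′-cases p with ∈-++⁻ (F s) p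
    ... | inj₁ q = inj₁ q
    ... | inj₂ q with i , i∈ , eq ← ∈-map⁻ _ q = inj₂ (i , proj₂ (∈-filter⁻ unlabelled? {xs = allFin k} i∈) , eq)

-- The successor invariant

R : ∀ {n} → State n → Edge n → Set
R s x = RStar (output s) x

labelled : ∀ {n} → State n → List (Fin n)
labelled {n} s = filter (λ v → 1 ≤? t s v) (allFin n)

module _ {n : ℕ} (s : State n) where

  labelled⁺ : ∀ {v} → 1 ≤ t s v → v ∈ labelled s
  labelled⁺ {v} = ∈-filter⁺ (λ v → 1 ≤? t s v) (∈-allFin v)

  labelled⁻ : ∀ {v} → v ∈ labelled s → 1 ≤ t s v
  labelled⁻ v∈ = proj₂ (∈-filter⁻ (λ v → 1 ≤? t s v) {xs = allFin n} v∈)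

  labelled-unique : Unique (labelled s)
  labelled-unique = Unique.filter⁺ (λ v → 1 ≤? t s v) (Unique.allFin⁺ n)

  length-labelled≤n : length (labelled s) ≤ n
  length-labelled≤n = ≤-trans (List.length-filter (λ v → 1 ≤? t s v) (allFin n)) (≤-reflexive (List.length-tabulate (λ i → i)))

-- Labels t name the current components: within a component the written
-- edges form a single δ-cycle, and F holds the one unwritten edge into each
-- labelled node.  Labels never exceed c ≤ n, so step 2 sees every label on C.

record SuccessorInvariant {n : ℕ} (s : State n) (δ : Edge n → Edge n) : Set where
  field
    δ-written : ∀ u v r → (u , v , r) ∈ output s → Σ (Fin n) λ w → r ≡ just w × δ (u , v) ≡ (v , w)
    δ-closed : ∀ x → R s x → R s (δ x)
    R-labelled : ∀ u v → R s (u , v) → t s u ≡ t s v × 1 ≤ t s v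
    same-label-reach : ∀ x y → R s x → R s y → t s (proj₂ x) ≡ t s (proj₂ y) → Reach δ x y
    labelled-has-F : ∀ v → 1 ≤ t s v → Σ (Fin n) λ u → (u , v) ∈ F s
    F-functional : ∀ u u′ v → (u , v) ∈ F s → (u′ , v) ∈ F s → u ≡ u′
    F-labelled : ∀ u v → (u , v) ∈ F s → 1 ≤ t s v
    F-unwritten : ∀ u v r → (u , v) ∈ F s → ¬ (u , v , r) ∈ out s
    label≤c : ∀ v → t s v ≤ c s
    c≤#labelled : c s ≤ length (labelled s)

module _ {n : ℕ} {s : State n} {δ : Edge n → Edge n} (I : SuccessorInvariant s δ) where
  open SuccessorInvariant I
  F⇒R : ∀ {u v} → (u , v) ∈ F s → R s (u , v)
  F⇒R f = j s _ , ∈-++⁺ʳ (out s) (∈-map⁺ _ f)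

  δ-shape : ∀ {u v} → R s (u , v) → Σ (Fin n) λ w → δ (u , v) ≡ (v , w)
  δ-shape {u} {v} (r , p) with δ-written u v r p
  ... | w , _ , e = w , e

  δ-preserves-label : ∀ {x} → R s x → t s (proj₂ (δ x)) ≡ t s (proj₂ x)
  δ-preserves-label {u , v} rx with δ-shape rx | δ-closed _ rx
  ... | w , e | rd rewrite e = sym (proj₁ (R-labelled v w rd))

  iter-in-R : ∀ {x} q → R s x → R s (iter δ q x) × t s (proj₂ (iter δ q x)) ≡ t s (proj₂ x)
  iter-in-R zero rx = rx , refl
  iter-in-R (suc q) rx with iter-in-R q rx
  ... | r , l = δ-closed _ r , trans (δ-preserves-label r) l

module Merge {n : ℕ} (s : State n) (m : ℕ) (C : Fin (suc m) → Fin n) (Js : List (Fin (suc m)))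
  (C-injective : Injective _≡_ _≡_ C) (valid : ValidJ (t s) C Js)
  (δ : Edge n → Edge n) (I : SuccessorInvariant s δ) where

  open MergeCycle s m C Js C-injective
  open WithValidJ valid
  open SuccessorInvariant I

  in-J? : ∀ i → Dec (i ∈ Js)
  in-J? i = Any.any? (i ≟ᶠ_) Js

  -- δ′ splices C into the old δ-cycles of the labels in M: an arc of C is
  -- followed by the next arc, except that on reaching a node of J it continues
  -- with the old successor stored in j there, while the F-edge into that node,
  -- whose successor this was, now continues along C.
  arc-succ : Fin k → Edge n
  arc-succ i with in-J? (nxt i)
  ... | yes _ = (C (nxt i) , fromMaybe (C (nxt i)) (j s (C (nxt i))))
  ... | no _ = arc (nxt i)

  δ-via-F : Edge n → Edge n
  δ-via-F (u , v) with on-cycle? v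
  ... | no _ = δ (u , v)
  ... | yes (i , _) with in-J? i | (u , v) ∈e? F s
  ...   | yes _ | yes _ = arc i
  ...   | yes _ | no _ = δ (u , v)
  ...   | no _ | _ = δ (u , v)

  δ′ : Edge n → Edge n
  δ′ (u , v) with on-cycle? u
  ... | no _ = δ-via-F (u , v)
  ... | yes (i , _) with v ≟ᶠ C (nxt i)
  ...   | yes _ = arc-succ i
  ...   | no _ = δ-via-F (u , v)

  δ′-arc : ∀ i → δ′ (arc i) ≡ arc-succ i
  δ′-arc i with on-cycle? (C i)
  ... | no ne = ⊥-elim (ne (i , refl))
  ... | yes (i′ , e) with C-injective e
  ...   | refl with C (nxt i) ≟ᶠ C (nxt i)
  ...     | yes _ = refl
  ...     | no ne = ⊥-elim (ne refl)

  arc-succ-J : ∀ i → nxt i ∈ Js → arc-succ i ≡ (C (nxt i) , fromMaybe (C (nxt i)) (j s (C (nxt i))))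
  arc-succ-J i p with in-J? (nxt i)
  ... | yes _ = refl
  ... | no np = ⊥-elim (np p)

  arc-succ-∉J : ∀ i → ¬ nxt i ∈ Js → arc-succ i ≡ arc (nxt i)
  arc-succ-∉J i np with in-J? (nxt i)
  ... | yes p = ⊥-elim (np p)
  ... | no _ = refl

  NotArc : Edge n → Set
  NotArc x = ∀ i → ¬ x ≡ arc i

  δ′-not-arc : ∀ x → NotArc x → δ′ x ≡ δ-via-F x
  δ′-not-arc (u , v) nc with on-cycle? u
  ... | no _ = refl
  ... | yes (i , e) with v ≟ᶠ C (nxt i)
  ...   | yes e2 = ⊥-elim (nc i (cong₂ _,_ (sym e) e2))
  ...   | no _ = refl

  δ-via-F-hit : ∀ i u → i ∈ Js → (u , C i) ∈ F s → δ-via-F (u , C i) ≡ arc i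
  δ-via-F-hit i u p f with on-cycle? (C i)
  ... | no ne = ⊥-elim (ne (i , refl))
  ... | yes (i′ , e) with C-injective e
  ...   | refl with in-J? i | (u , C i) ∈e? F s
  ...     | yes _ | yes _ = refl
  ...     | yes _ | no nf = ⊥-elim (nf f)
  ...     | no np | _ = ⊥-elim (np p)

  δ-via-F-miss : ∀ u v → (∀ i → i ∈ Js → (u , v) ∈ F s → ¬ v ≡ C i) → δ-via-F (u , v) ≡ δ (u , v)
  δ-via-F-miss u v h with on-cycle? v
  ... | no _ = refl
  ... | yes (i , e) with in-J? i | (u , v) ∈e? F s
  ...   | yes p | yes f = ⊥-elim (h i p f (sym e))
  ...   | yes _ | no _ = refl
  ...   | no _ | _ = refl

  label≤n : ∀ v → t s v ≤ n
  label≤n v = ≤-trans (label≤c v) (≤-trans c≤#labelled (length-labelled≤n s))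

  cycle-label∈M : ∀ i → 1 ≤ t s (C i) → t s (C i) ∈ M
  cycle-label∈M i le = Any.map⁺ (Any.map sym (proj₂ (proj₂ valid) i le (label≤n (C i))))

  ∈M⇒J : ∀ {b} → b ∈ M → Σ (Fin k) λ i → i ∈ Js × b ≡ t s (C i)
  ∈M⇒J p = ∈-map⁻ (λ i → t s (C i)) p

  J-label-injective : ∀ {i i′} → i ∈ Js → i′ ∈ Js → t s (C i) ≡ t s (C i′) → i ≡ i′
  J-label-injective {i} {i′} p p′ e with i ≟ᶠ i′
  ... | yes eq = eq
  ... | no ne with AllPairs-lookup (proj₁ (proj₂ valid)) p p′ ne
  ...   | inj₁ d = ⊥-elim (d e)
  ...   | inj₂ d = ⊥-elim (d (sym e))

  foldr-⊓-∈ : ∀ x xs → foldr _⊓_ x xs ∈ (x ∷ xs)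
  foldr-⊓-∈ x xs with foldr-selective ⊓-sel x xs
  ... | inj₁ ≡x = here ≡x
  ... | inj₂ ∈xs = there ∈xs

  M-positive : ∀ {b} → b ∈ M → 1 ≤ b
  M-positive p with ∈M⇒J p
  ... | i , i∈ , refl = J-labelled i∈

  M≤c : ∀ {b} → b ∈ M → b ≤ c s
  M≤c p with ∈M⇒J p
  ... | i , i∈ , refl = label≤c (C i)

  a-cases : (M ≡ [] × a ≡ suc (c s) × c s′ ≡ suc (c s)) ⊎ (a ∈ M × c s′ ≡ c s)
  a-cases with M
  ... | [] = inj₁ (refl , refl , refl)
  ... | x ∷ xs = inj₂ (foldr-⊓-∈ x xs , refl)

  a-positive : 1 ≤ a
  a-positive with a-cases
  ... | inj₁ (_ , e , _) rewrite e = s≤s z≤n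
  ... | inj₂ (p , _) = M-positive p

  ∉M⇒≢a : ∀ v → ¬ t s v ∈ M → ¬ t s v ≡ a
  ∉M⇒≢a v nm e with a-cases
  ... | inj₁ (_ , ea , _) = <⇒≢ (s≤s (label≤c v)) (trans e ea)
  ... | inj₂ (p , _) = nm (subst (_∈ M) (sym e) p)

  t′-cases : ∀ v → (t s′ v ≡ a × ((∃ λ i → C i ≡ v) ⊎ t s v ∈ M)) ⊎ (t s′ v ≡ t s v × ¬ t s v ∈ M × (∀ i → ¬ C i ≡ v))
  t′-cases v = classify (on-cycle? v) (in-M? v)
    where
    classify : Dec (∃ λ i → C i ≡ v) → Dec (t s v ∈ M) →
               (t s′ v ≡ a × ((∃ λ i → C i ≡ v) ⊎ t s v ∈ M)) ⊎ (t s′ v ≡ t s v × ¬ t s v ∈ M × (∀ i → ¬ C i ≡ v))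
    classify (yes (i , e)) _ = inj₁ (subst (λ w → t s′ w ≡ a) e (t′-on-cycle i) , inj₁ (i , e))
    classify (no nc) (yes p) = inj₁ (t′-merged v p , inj₂ p)
    classify (no nc) (no np) = inj₂ (t′-elsewhere v (λ i e → nc (i , e)) np , np , λ i e → nc (i , e))

  open MinimalReach _≟e_ δ

  F⇒output : ∀ {u v} → (u , v) ∈ F s → (u , v , j s v) ∈ output s
  F⇒output f = ∈-++⁺ʳ (out s) (∈-map⁺ _ f)

  J-has-F : ∀ {i} → i ∈ Js → Σ (Fin n) λ u → (u , C i) ∈ F s
  J-has-F {i} p = labelled-has-F (C i) (J-labelled p)

  module Fresh (fresh-arcs : ∀ i → ¬ R s (arc i)) where
    R⇒not-arc : ∀ {x} → R s x → NotArc x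
    R⇒not-arc r i e = fresh-arcs i (subst (R s) e r)

    δ′-old : ∀ {u v} → R s (u , v) → (∀ i → i ∈ Js → (u , v) ∈ F s → ¬ v ≡ C i) → δ′ (u , v) ≡ δ (u , v)
    δ′-old {u} {v} r nch = trans (δ′-not-arc _ (R⇒not-arc r)) (δ-via-F-miss u v nch)

    δ′-F-into-J : ∀ {i u} → i ∈ Js → (u , C i) ∈ F s → δ′ (u , C i) ≡ arc i
    δ′-F-into-J {i} {u} p f = trans (δ′-not-arc _ (R⇒not-arc (F⇒R I f))) (δ-via-F-hit i u p f)

    reach′-outside-M : ∀ {x y} → R s x → ¬ t s (proj₂ x) ∈ M → Reach δ x y → Reach δ′ x y
    reach′-outside-M {x} rx nm (k , p) = reach-transfer δ δ′ k p h
      where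
      h : ∀ q → q < k → δ′ (iter δ q x) ≡ δ (iter δ q x)
      h q _ with iter δ q x | iter-in-R I q rx
      ... | (u , v) | rz , lz = δ′-old rz (λ i i∈ f e → nm (subst (_∈ M) (trans (cong (t s) (sym e)) lz) (∈-map⁺ (λ i → t s (C i)) i∈)))

    -- Within the class of J-node C i₀, δ′ differs from δ only at the F-edge into
    -- C i₀, so a δ-path avoiding that edge is a δ′-path.
    reach′-in-class : ∀ {i₀ u₀ x y} k → i₀ ∈ Js → (u₀ , C i₀) ∈ F s → R s x → t s (proj₂ x) ≡ t s (C i₀) →
                     iter δ k x ≡ y → (∀ q → q < k → ¬ iter δ q x ≡ (u₀ , C i₀)) → Reach δ′ x y
    reach′-in-class {i₀} {u₀} {x} k p₀ f₀ rx lx p av = reach-transfer δ δ′ k p h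
      where
      h : ∀ q → q < k → δ′ (iter δ q x) ≡ δ (iter δ q x)
      h q lt with iter δ q x in eqz | iter-in-R I q rx
      ... | (u , v) | rz , lz = δ′-old rz ch
        where
        ch : ∀ i → i ∈ Js → (u , v) ∈ F s → ¬ v ≡ C i
        ch i i∈ f e with J-label-injective i∈ p₀ (trans (cong (t s) (sym e)) (trans lz lx))
        ... | refl with F-functional u u₀ (C i) (subst (λ w → (u , w) ∈ F s) e f) f₀
        ...   | refl = av q lt (trans eqz (cong (u ,_) e))

    δ′-arc-into-J : ∀ i′ u → nxt i′ ∈ Js → (u , C (nxt i′)) ∈ F s → δ′ (arc i′) ≡ δ (u , C (nxt i′))
    δ′-arc-into-J i′ u p f with δ-written u (C (nxt i′)) (j s (C (nxt i′))) (F⇒output f)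
    ... | w , ej , ed = trans (δ′-arc i′) (trans (arc-succ-J i′ p) (trans (cong (λ z → (C (nxt i′) , fromMaybe (C (nxt i′)) z)) ej) (sym ed)))

    reach′-from-arc : ∀ i′ u → nxt i′ ∈ Js → (u , C (nxt i′)) ∈ F s → ∀ y → R s y → t s (proj₂ y) ≡ t s (C (nxt i′)) → Reach δ′ (arc i′) y
    reach′-from-arc i′ u p f y ry ly
      with minimal-reach (same-label-reach (δ (u , C (nxt i′))) y (δ-closed _ (F⇒R I f)) ry (trans (δ-preserves-label I (F⇒R I f)) (sym ly)))
    ... | k , pk , mn = reach-trans (reach-step (δ′-arc-into-J i′ u p f))
          (reach′-in-class k p f (δ-closed _ (F⇒R I f)) (δ-preserves-label I (F⇒R I f)) pk (minimal-reach-avoids k refl pk mn))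

    reach′-to-arc : ∀ i₀ u → i₀ ∈ Js → (u , C i₀) ∈ F s → ∀ y → R s y → t s (proj₂ y) ≡ t s (C i₀) → Reach δ′ y (arc i₀)
    reach′-to-arc i₀ u p f y ry ly with minimal-reach (same-label-reach y (u , C i₀) ry (F⇒R I f) ly)
    ... | k , pk , mn = reach-trans (reach′-in-class k p f ry ly pk mn) (reach-step (δ′-F-into-J p f))

    arc-reach-next : ∀ i → Reach δ′ (arc i) (arc (nxt i))
    arc-reach-next i with in-J? (nxt i)
    ... | no np = reach-step (trans (δ′-arc i) (arc-succ-∉J i np))
    ... | yes p with J-has-F p
    ...   | u , f = reach-trans (reach′-from-arc i u p f (u , C (nxt i)) (F⇒R I f) refl) (reach-step (δ′-F-into-J p f))

    arc-reach-iter : ∀ i d → Reach δ′ (arc i) (arc (iter nxt d i))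
    arc-reach-iter i zero = reach-refl
    arc-reach-iter i (suc d) = reach-trans (arc-reach-iter i d) (arc-reach-next (iter nxt d i))

    arc-reach-arc : ∀ i i′ → Reach δ′ (arc i) (arc i′)
    arc-reach-arc i i′ with nxt-reaches i i′
    ... | d , e = subst (λ z → Reach δ′ (arc i) (arc z)) e (arc-reach-iter i d)

    Merged : Edge n → Set
    Merged x = (∃ λ i → x ≡ arc i) ⊎ (R s x × t s (proj₂ x) ∈ M)

    hub : Edge n
    hub = arc Fin.zero

    merged-reach-hub : ∀ x → Merged x → Reach δ′ x hub
    merged-reach-hub x (inj₁ (i , refl)) = arc-reach-arc i Fin.zero
    merged-reach-hub x (inj₂ (rx , bm)) with ∈M⇒J bm
    ... | i₀ , p , e with J-has-F p
    ...   | u , f = reach-trans (reach′-to-arc i₀ u p f x rx e) (arc-reach-arc i₀ Fin.zero)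

    hub-reach-merged : ∀ x → Merged x → Reach δ′ hub x
    hub-reach-merged x (inj₁ (i , refl)) = arc-reach-arc Fin.zero i
    hub-reach-merged x (inj₂ (rx , bm)) with ∈M⇒J bm
    ... | i₀ , p , e with J-has-F p
    ...   | u , f = reach-trans (arc-reach-arc Fin.zero (prv i₀))
                      (reach′-from-arc (prv i₀) u (subst (_∈ Js) (sym (nxt-prv i₀)) p) (subst (λ z → (u , C z) ∈ F s) (sym (nxt-prv i₀)) f) x rx
                          (trans e (cong (λ z → t s (C z)) (sym (nxt-prv i₀)))))

    δ′-entering-J : ∀ i u → i ∈ Js → (u , C i) ∈ F s → δ′ (C (prv i) , C i) ≡ δ (u , C i)
    δ′-entering-J i u p f = subst (λ z → δ′ (C (prv i) , C z) ≡ δ (u , C z)) (nxt-prv i)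
      (δ′-arc-into-J (prv i) u (subst (_∈ Js) (sym (nxt-prv i)) p) (subst (λ z → (u , C z) ∈ F s) (sym (nxt-prv i)) f))

    δ′-entering-∉J : ∀ i → ¬ i ∈ Js → δ′ (C (prv i) , C i) ≡ arc i
    δ′-entering-∉J i np = subst (λ z → δ′ (C (prv i) , C z) ≡ arc z) (nxt-prv i)
      (trans (δ′-arc (prv i)) (arc-succ-∉J (prv i) (λ q → np (subst (_∈ Js) (nxt-prv i) q))))

    δ′-old-cases : ∀ {u v} → R s (u , v) → (δ′ (u , v) ≡ δ (u , v)) ⊎ (∃ λ i → δ′ (u , v) ≡ arc i)
    δ′-old-cases {u} {v} r with on-cycle? v
    ... | no nc = inj₁ (δ′-old r (λ i _ _ e → nc (i , sym e)))
    ... | yes (i , e) with in-J? i | (u , v) ∈e? F s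
    ...   | yes p | yes f = inj₂ (i , subst (λ w → δ′ (u , w) ≡ arc i) e (δ′-F-into-J p (subst (λ w → (u , w) ∈ F s) (sym e) f)))
    ...   | yes p | no nf = inj₁ (δ′-old r (λ _ _ f _ → nf f))
    ...   | no np | _ = inj₁ (δ′-old r (λ i′ p′ _ e′ → np (subst (_∈ Js) (sym (C-injective (trans e e′))) p′)))

    δ′-written : ∀ u v r → (u , v , r) ∈ output s′ → Σ (Fin n) λ w → r ≡ just w × δ′ (u , v) ≡ (v , w)
    δ′-written u v r p with output-cases p
    ... | written-out (out-before old) with δ-written u v r (∈-++⁺ˡ old)
    ...   | w , e1 , e2 = w , e1 , trans (δ′-old (r , ∈-++⁺ˡ old) (λ i _ f _ → F-unwritten u v r f old)) e2
    δ′-written u v r p | written-out (out-at-J i i∈ refl refl e) with J-has-F i∈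
    ... | u₀ , f with δ-written u₀ (C i) (j s (C i)) (F⇒output f)
    ...   | w , e1 , e2 = w , trans e e1 , trans (δ′-entering-J i u₀ i∈ f) e2
    δ′-written u v r p | written-out (out-step4 i nJ _ refl refl e) = _ , e , trans (δ′-arc i) (arc-succ-∉J i nJ)
    δ′-written u v r p | final-new-F i z refl refl e = _ , trans e (j′-unlabelled i z) , δ′-entering-∉J i (λ i∈ → J-label≢0 i∈ z)
    δ′-written u v r p | final-old-F f e with on-cycle? v
    ... | yes (i , ev) with in-J? i
    ...   | yes i∈ = _ , trans e (subst (λ w → j s′ w ≡ just (C (nxt i))) ev (j′-on-J i i∈)) ,
                     subst (λ w → δ′ (u , w) ≡ (w , C (nxt i))) ev (δ′-F-into-J i∈ (subst (λ w → (u , w) ∈ F s) (sym ev) f))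
    ...   | no ni with δ-written u v (j s v) (F⇒output f)
    ...     | w , e1 , e2 = w , trans e (trans (j′-elsewhere v oth) e1) , trans (δ′-old (F⇒R I f) nch) e2
      where
      oth : ∀ i′ → C i′ ≡ v → ¬ i′ ∈ Js × ¬ t s (C i′) ≡ 0
      oth i′ e′ with C-injective (trans e′ (sym ev))
      ... | refl = ni , λ z → <⇒≢ (subst (1 ≤_) (cong (t s) (sym e′)) (F-labelled u v f)) (sym z)
      nch : ∀ i′ → i′ ∈ Js → (u , v) ∈ F s → ¬ v ≡ C i′
      nch i′ p _ e′ with C-injective (trans ev e′)
      ... | refl = ni p
    δ′-written u v r p | final-old-F f e | no nc with δ-written u v (j s v) (F⇒output f)
    ... | w , e1 , e2 = w , trans e (trans (j′-elsewhere v (λ i′ e′ → ⊥-elim (nc (i′ , e′)))) e1) ,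
                        trans (δ′-old (F⇒R I f) (λ i′ _ _ e′ → nc (i′ , sym e′))) e2

    t′-of-labelled : ∀ w → 1 ≤ t s w → (t s′ w ≡ a × t s w ∈ M) ⊎ (t s′ w ≡ t s w × ¬ t s w ∈ M)
    t′-of-labelled w le with t′-cases w
    ... | inj₁ (e , inj₁ (i , ei)) = inj₁ (e , subst (λ z → t s z ∈ M) ei (cycle-label∈M i (subst (λ z → 1 ≤ t s z) (sym ei) le)))
    ... | inj₁ (e , inj₂ p) = inj₁ (e , p)
    ... | inj₂ (e , nm , _) = inj₂ (e , nm)

    δ′-closed : ∀ x → R s′ x → R s′ (δ′ x)
    δ′-closed x rx with R′-cases rx
    δ′-closed x rx | inj₂ (i , refl) with in-J? (nxt i)
    ... | yes p with J-has-F p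
    ...   | u , f = subst (R s′) (sym (δ′-arc-into-J i u p f)) (R′-old (δ-closed _ (F⇒R I f)))
    δ′-closed x rx | inj₂ (i , refl) | no np = subst (R s′) (sym (trans (δ′-arc i) (arc-succ-∉J i np))) (R′-arc fresh-arcs (nxt i))
    δ′-closed (u , v) rx | inj₁ r with δ′-old-cases r
    ... | inj₁ e = subst (R s′) (sym e) (R′-old (δ-closed _ r))
    ... | inj₂ (i , e) = subst (R s′) (sym e) (R′-arc fresh-arcs i)

    R′-labelled : ∀ u v → R s′ (u , v) → t s′ u ≡ t s′ v × 1 ≤ t s′ v
    R′-labelled u v rx with R′-cases rx
    ... | inj₂ (i , refl) = trans (t′-on-cycle i) (sym (t′-on-cycle (nxt i))) , subst (1 ≤_) (sym (t′-on-cycle (nxt i))) a-positive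
    ... | inj₁ r with R-labelled u v r
    ...   | eq , le with t′-of-labelled u (subst (1 ≤_) (sym eq) le) | t′-of-labelled v le
    ...     | inj₁ (e1 , _) | inj₁ (e2 , _) = trans e1 (sym e2) , subst (1 ≤_) (sym e2) a-positive
    ...     | inj₂ (e1 , _) | inj₂ (e2 , _) = trans e1 (trans eq (sym e2)) , subst (1 ≤_) (sym e2) le
    ...     | inj₁ (_ , m1) | inj₂ (_ , nm) = ⊥-elim (nm (subst (_∈ M) eq m1))
    ...     | inj₂ (_ , nm) | inj₁ (_ , m2) = ⊥-elim (nm (subst (_∈ M) (sym eq) m2))

    R′-classify : ∀ x → R s′ x → (Merged x × t s′ (proj₂ x) ≡ a) ⊎ (R s x × ¬ t s (proj₂ x) ∈ M × t s′ (proj₂ x) ≡ t s (proj₂ x))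
    R′-classify x rx with R′-cases rx
    ... | inj₂ (i , refl) = inj₁ (inj₁ (i , refl) , t′-on-cycle (nxt i))
    R′-classify (u , v) rx | inj₁ r with t′-of-labelled v (proj₂ (R-labelled u v r))
    ... | inj₁ (e , m) = inj₁ (inj₂ (r , m) , e)
    ... | inj₂ (e , nm) = inj₂ (r , nm , e)

    same-label-reach′ : ∀ x y → R s′ x → R s′ y → t s′ (proj₂ x) ≡ t s′ (proj₂ y) → Reach δ′ x y
    same-label-reach′ x y rx ry e with R′-classify x rx | R′-classify y ry
    ... | inj₁ (nx , _) | inj₁ (ny , _) = reach-trans (merged-reach-hub x nx) (hub-reach-merged y ny)
    ... | inj₂ (r1 , nm1 , e1) | inj₂ (r2 , nm2 , e2) = reach′-outside-M r1 nm1 (same-label-reach x y r1 r2 (trans (sym e1) (trans e e2)))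
    ... | inj₁ (_ , e1) | inj₂ (_ , nm2 , e2) = ⊥-elim (∉M⇒≢a (proj₂ y) nm2 (trans (sym e2) (trans (sym e) e1)))
    ... | inj₂ (_ , nm1 , e1) | inj₁ (_ , e2) = ⊥-elim (∉M⇒≢a (proj₂ x) nm1 (trans (sym e1) (trans e e2)))

    labelled-has-F′ : ∀ v → 1 ≤ t s′ v → Σ (Fin n) λ u → (u , v) ∈ F s′
    labelled-has-F′ v le with 1 ≤? t s v
    ... | yes le0 with labelled-has-F v le0
    ...   | u , f = u , F′-old f
    labelled-has-F′ v le | no nle with t′-cases v
    ... | inj₁ (_ , inj₁ (i , ei)) = C (prv i) , subst (λ w → (C (prv i) , w) ∈ F s′) ei
            (F′-new i (n<1⇒n≡0 (≰⇒> (λ lt → nle (subst (λ w → 1 ≤ t s w) ei lt)))))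
    ... | inj₁ (_ , inj₂ p) = ⊥-elim (nle (M-positive p))
    ... | inj₂ (e , _) = ⊥-elim (nle (subst (1 ≤_) e le))

    F′-functional : ∀ u u′ v → (u , v) ∈ F s′ → (u′ , v) ∈ F s′ → u ≡ u′
    F′-functional u u′ v f f′ with F′-cases f | F′-cases f′
    ... | inj₁ a1 | inj₁ a2 = F-functional u u′ v a1 a2
    ... | inj₁ a1 | inj₂ (i , z , refl) = ⊥-elim (<⇒≢ (F-labelled u _ a1) (sym z))
    ... | inj₂ (i , z , refl) | inj₁ a2 = ⊥-elim (<⇒≢ (F-labelled u′ _ a2) (sym z))
    ... | inj₂ (i , z , e1) | inj₂ (i′ , z′ , e2) with C-injective (trans (sym (cong proj₂ e1)) (cong proj₂ e2))
    ...   | refl = trans (cong proj₁ e1) (sym (cong proj₁ e2))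

    F′-labelled : ∀ u v → (u , v) ∈ F s′ → 1 ≤ t s′ v
    F′-labelled u v f with F′-cases f
    ... | inj₂ (i , z , refl) = subst (1 ≤_) (sym (t′-on-cycle i)) a-positive
    ... | inj₁ f0 with t′-of-labelled v (F-labelled u v f0)
    ...   | inj₁ (e , _) = subst (1 ≤_) (sym e) a-positive
    ...   | inj₂ (e , _) = subst (1 ≤_) (sym e) (F-labelled u v f0)

    F′-unwritten : ∀ u v r → (u , v) ∈ F s′ → ¬ (u , v , r) ∈ out s′
    F′-unwritten u v r f q with out-cases q
    ... | out-step4 i _ nF refl refl _ = nF f
    ... | out-at-J i i∈ refl refl _ with F′-cases f
    ...   | inj₁ f0 = fresh-arcs (prv i) (subst (R s) (arc-prv i) (F⇒R I f0))
    ...   | inj₂ (i′ , z , e) with C-injective (cong proj₂ e)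
    ...     | refl = J-label≢0 i∈ z
    F′-unwritten u v r f q | out-before old with F′-cases f
    ... | inj₁ f0 = F-unwritten u v r f0 old
    ... | inj₂ (i , z , refl) = fresh-arcs (prv i) (subst (R s) (arc-prv i) (r , ∈-++⁺ˡ old))

    c≤c′ : c s ≤ c s′
    c≤c′ with a-cases
    ... | inj₁ (_ , _ , ec) = subst (c s ≤_) (sym ec) (n≤1+n _)
    ... | inj₂ (_ , ec) = ≤-reflexive (sym ec)

    a≤c′ : a ≤ c s′
    a≤c′ with a-cases
    ... | inj₁ (_ , ea , ec) = ≤-reflexive (trans ea (sym ec))
    ... | inj₂ (p , ec) = subst (a ≤_) (sym ec) (M≤c p)

    label≤c′ : ∀ v → t s′ v ≤ c s′
    label≤c′ v with t′-cases v
    ... | inj₁ (e , _) = subst (_≤ c s′) (sym e) a≤c′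
    ... | inj₂ (e , _) = subst (_≤ c s′) (sym e) (≤-trans (label≤c v) c≤c′)


    labelled-mono : ∀ {v} → v ∈ labelled s → v ∈ labelled s′
    labelled-mono {v} p with t′-of-labelled v (labelled⁻ s p)
    ... | inj₁ (e , _) = labelled⁺ s′ (subst (1 ≤_) (sym e) a-positive)
    ... | inj₂ (e , _) = labelled⁺ s′ (subst (1 ≤_) (sym e) (labelled⁻ s p))

    c′≤#labelled′ : c s′ ≤ length (labelled s′)
    c′≤#labelled′ with a-cases
    ... | inj₂ (_ , ec) = subst (_≤ length (labelled s′)) (sym ec)
                            (≤-trans c≤#labelled (length-≤-of-unique-⊆ (labelled s) (labelled s′) (labelled-unique s) labelled-mono))
    ... | inj₁ (eM , ea , ec) = subst (_≤ length (labelled s′)) (sym ec)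
                            (≤-trans (s≤s c≤#labelled) (length-≤-of-unique-⊆ (C Fin.zero ∷ labelled s) (labelled s′) uq sub))
      where
      z0 : ¬ 1 ≤ t s (C Fin.zero)
      z0 le with cycle-label∈M Fin.zero le
      ... | p rewrite eM with p
      ...   | ()
      uq : Unique (C Fin.zero ∷ labelled s)
      uq = All.tabulate (λ {v} p e → z0 (subst (λ w → 1 ≤ t s w) (sym e) (labelled⁻ s p))) ∷ labelled-unique s
      sub : ∀ {x} → x ∈ (C Fin.zero ∷ labelled s) → x ∈ labelled s′
      sub (here refl) = labelled⁺ s′ (subst (1 ≤_) (sym (t′-on-cycle Fin.zero)) a-positive)
      sub (there p) = labelled-mono p

    successor-invariant′ : SuccessorInvariant s′ δ′
    successor-invariant′ = record
      { δ-written = δ′-written ; δ-closed = δ′-closed ; R-labelled = R′-labelled ; same-label-reach = same-label-reach′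
      ; labelled-has-F = labelled-has-F′ ; F-functional = F′-functional ; F-labelled = F′-labelled
      ; F-unwritten = F′-unwritten ; label≤c = label≤c′ ; c≤#labelled = c′≤#labelled′ }

-- The edge invariant

-- rest is the unread suffix of the stream.
record EdgeInvariant {n : ℕ} (S : List (Edge n)) (s : State n) (rest : List (Edge n)) : Set where
  field
    R-oriented : ∀ x → R s x → ¬ R s (swap x)
    S-covered : ∀ x → x ∈ᵤ S → (R s x ⊎ R s (swap x)) ⊎ (x ∈ᵤ Eint s ⊎ x ∈ᵤ rest)
    R⊆S : ∀ x → R s x → x ∈ᵤ S
    R∉Eint : ∀ x → R s x → ¬ x ∈ᵤ Eint s
    R∉rest : ∀ x → R s x → ¬ x ∈ᵤ rest
    Eint-distinct : Distinct (Eint s)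
    rest-distinct : Distinct rest
    Eint-disjoint-rest : ∀ x → x ∈ Eint s → ¬ x ∈ᵤ rest
    Eint-loopless : All Loopless (Eint s)
    rest-loopless : All Loopless rest
    Eint-acyclic : ¬ Cycle (Eint s)
    even-degree : ∀ v → 2 ∣ degree v (Eint s) + degree v rest
    Eint⊆S : ∀ x → x ∈ᵤ Eint s → x ∈ᵤ S
    rest⊆S : ∀ x → x ∈ᵤ rest → x ∈ᵤ S

module _ {n : ℕ} where
  module Incoming {S : List (Edge n)} {s : State n} {e : Edge n} {rest′ : List (Edge n)} (EI : EdgeInvariant S s (e ∷ rest′)) where
    open EdgeInvariant EI

    e∉rest′ : ¬ e ∈ᵤ rest′
    e∉rest′ p with rest-distinct
    ... | ne ∷ _ with find p
    ...   | y , y∈ , sm = All.lookup ne y∈ sm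

    Eint+-distinct : Distinct (e ∷ Eint s)
    Eint+-distinct = All.tabulate (λ {y} y∈ sm → Eint-disjoint-rest y y∈ (here (sameEdge-sym sm))) ∷ Eint-distinct

    Eint+-loopless : All Loopless (e ∷ Eint s)
    Eint+-loopless = All.head rest-loopless ∷ Eint-loopless

    Eint+-disjoint-rest′ : ∀ x → x ∈ (e ∷ Eint s) → ¬ x ∈ᵤ rest′
    Eint+-disjoint-rest′ x (here refl) = e∉rest′
    Eint+-disjoint-rest′ x (there p) q = Eint-disjoint-rest x p (there q)

    R∉Eint+ : ∀ x → R s x → ¬ x ∈ᵤ (e ∷ Eint s)
    R∉Eint+ x r (here sm) = R∉rest x r (here sm)
    R∉Eint+ x r (there p) = R∉Eint x r p

    Eint+⊆S : ∀ x → x ∈ᵤ (e ∷ Eint s) → x ∈ᵤ S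
    Eint+⊆S x (here sm) = rest⊆S x (here sm)
    Eint+⊆S x (there p) = Eint⊆S x p

    degree-shift : ∀ v → degree v (e ∷ Eint s) + degree v rest′ ≡ degree v (Eint s) + degree v (e ∷ rest′)
    degree-shift v = begin
      degree v (e ∷ Eint s) + degree v rest′           ≡⟨ cong (_+ degree v rest′) (length-filter-∷ (touches? v) e (Eint s)) ⟩
      degree v (e ∷ []) + degree v (Eint s) + degree v rest′ ≡⟨ solve 3 (λ x E r → x :+ E :+ r := E :+ (x :+ r)) refl (degree v (e ∷ [])) _ _ ⟩
      degree v (Eint s) + (degree v (e ∷ []) + degree v rest′) ≡⟨ cong (degree v (Eint s) +_) (length-filter-∷ (touches? v) e rest′) ⟨
      degree v (Eint s) + degree v (e ∷ rest′)         ∎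
      where open ≡-Reasoning
            open +-*-Solver

  edge-invariant-init : ∀ (S : List (Edge n)) → SimpleStream S → Eulerian S → EdgeInvariant S initState S
  edge-invariant-init S (loopless , distinct) eulerian = record
    { R-oriented = λ x () ; S-covered = λ x x∈ → inj₂ (inj₂ x∈) ; R⊆S = λ x () ; R∉Eint = λ x () ; R∉rest = λ x ()
    ; Eint-distinct = [] ; rest-distinct = distinct ; Eint-disjoint-rest = λ x ()
    ; Eint-loopless = [] ; rest-loopless = loopless ; Eint-acyclic = empty-acyclic
    ; even-degree = eulerian⇒even-degree S (loopless , distinct) eulerian ; Eint⊆S = λ x () ; rest⊆S = λ x x∈ → x∈ }
    where
    empty-acyclic : ¬ Cycle {n} []
    empty-acyclic (_ , _ , _ , _ , edges) with () ← edges Fin.zero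

  edge-invariant-no-cycle : ∀ {S} {s : State n} {e rest′} → EdgeInvariant S s (e ∷ rest′) → ¬ Cycle (e ∷ Eint s) →
             EdgeInvariant S (record s { Eint = e ∷ Eint s }) rest′
  edge-invariant-no-cycle {S} {s} {e} {rest′} EI acyclic = record
    { R-oriented = R-oriented ; S-covered = S-covered′ ; R⊆S = R⊆S ; R∉Eint = R∉Eint+ ; R∉rest = λ x r p → R∉rest x r (there p)
    ; Eint-distinct = Eint+-distinct ; rest-distinct = AllPairs.tail rest-distinct ; Eint-disjoint-rest = Eint+-disjoint-rest′
    ; Eint-loopless = Eint+-loopless ; rest-loopless = All.tail rest-loopless ; Eint-acyclic = acyclic
    ; even-degree = λ v → subst (2 ∣_) (sym (degree-shift v)) (even-degree v) ; Eint⊆S = Eint+⊆S ; rest⊆S = λ x p → rest⊆S x (there p) }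
    where
    open EdgeInvariant EI
    open Incoming EI
    S-covered′ : ∀ x → x ∈ᵤ S → (R s x ⊎ R s (swap x)) ⊎ (x ∈ᵤ (e ∷ Eint s) ⊎ x ∈ᵤ rest′)
    S-covered′ x p with S-covered x p
    ... | inj₁ r = inj₁ r
    ... | inj₂ (inj₁ q) = inj₂ (inj₁ (there q))
    ... | inj₂ (inj₂ (here sm)) = inj₂ (inj₁ (here sm))
    ... | inj₂ (inj₂ (there q)) = inj₂ (inj₂ q)

  module MergeEdges {S : List (Edge n)} {s : State n} {e : Edge n} {rest′ : List (Edge n)} (EI : EdgeInvariant S s (e ∷ rest′))
    (m : ℕ) (C : Fin (suc m) → Fin n) (Js : List (Fin (suc m))) (m2 : 2 ≤ m) (C-injective : Injective _≡_ _≡_ C)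
    (cyc : ∀ i → (C i , C (nxt i)) ∈ᵤ (e ∷ Eint s)) (valid : ValidJ (t s) C Js) where

    s₊ : State n
    s₊ = record s { Eint = e ∷ Eint s }
    open MergeCycle s₊ m C Js C-injective
    open WithValidJ valid
    open EdgeInvariant EI
    open Incoming EI

    fresh-arcs : ∀ i → ¬ R s₊ (arc i)
    fresh-arcs i r = R∉Eint+ (arc i) r (cyc i)

    fresh-arcs-unoutput : ∀ i {y} → SameEdge y (arc i) → ¬ R s y
    fresh-arcs-unoutput i sm r = R∉Eint+ _ r (∈ᵤ-resp sm (cyc i))

    arcs : List (Edge n)
    arcs = map arc (allFin k)

    on-arcs? : ∀ x → Dec (x ∈ᵤ arcs)
    on-arcs? x = x ∈ᵤ? arcs

    arc∈arcs : ∀ i → arc i ∈ᵤ arcs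
    arc∈arcs i = ∈⇒∈ᵤ (∈-map⁺ arc (∈-allFin i))

    on-arcs⇒ : ∀ {x} → x ∈ᵤ arcs → Σ (Fin k) λ i → SameEdge x (arc i)
    on-arcs⇒ p with find p
    ... | y , y∈ , sm with ∈-map⁻ arc y∈
    ...   | i , _ , refl = i , sm

    Eint′ : List (Edge n)
    Eint′ = filter (λ x → ¬? (on-arcs? x)) (e ∷ Eint s)

    Eint′⁻ : ∀ {x} → x ∈ Eint′ → x ∈ (e ∷ Eint s) × ¬ x ∈ᵤ arcs
    Eint′⁻ p = ∈-filter⁻ (λ x → ¬? (on-arcs? x)) {xs = e ∷ Eint s} p

    Eint′⁺ : ∀ {x} → x ∈ (e ∷ Eint s) → ¬ x ∈ᵤ arcs → x ∈ Eint′
    Eint′⁺ p q = ∈-filter⁺ (λ x → ¬? (on-arcs? x)) p q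

    swap-arc≢arc : ∀ i i′ → ¬ swap (arc i) ≡ arc i′
    swap-arc≢arc i i′ eq with C-injective (cong proj₁ eq) | C-injective (cong proj₂ eq)
    ... | refl | e2 = nxt²-irreflexive m2 i (sym e2)

    cycle-in-Eint : ¬ e ∈ᵤ arcs → Cycle (Eint s)
    cycle-in-Eint e∉arcs = m , C , m2 , C-injective , λ i → not-e i (cyc i)
      where not-e : ∀ i → arc i ∈ᵤ (e ∷ Eint s) → arc i ∈ᵤ Eint s
            not-e i (here sm) = ⊥-elim (e∉arcs (∈ᵤ-resp (sameEdge-sym sm) (arc∈arcs i)))
            not-e i (there q) = q

    -- Eint was acyclic, so the cycle must use the new edge e.
    e-on-cycle : e ∈ᵤ arcs
    e-on-cycle with on-arcs? e
    ... | yes p = p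
    ... | no np = ⊥-elim (Eint-acyclic (cycle-in-Eint np))

    Eint′⊆Eint : ∀ {x} → x ∈ᵤ Eint′ → x ∈ᵤ Eint s
    Eint′⊆Eint p with find p
    ... | y , y∈ , sm with Eint′⁻ y∈
    ...   | here refl , nc = ⊥-elim (nc e-on-cycle)
    ...   | there q , _ = ∈ᵤ-resp sm (∈⇒∈ᵤ q)

    Eint′⊆Eint+ : ∀ {x} → x ∈ᵤ Eint′ → x ∈ᵤ (e ∷ Eint s)
    Eint′⊆Eint+ p = there (Eint′⊆Eint p)

    arcs-at : Fin n → List (Edge n)
    arcs-at v = filter (touches? v) (filter on-arcs? (e ∷ Eint s))

    arcs-at-distinct : ∀ v → Distinct (arcs-at v)
    arcs-at-distinct v = AllPairs.filter⁺ (touches? v) (AllPairs.filter⁺ on-arcs? Eint+-distinct)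

    arcs-at⁻ : ∀ {v y} → y ∈ arcs-at v → Touches v y × y ∈ᵤ arcs
    arcs-at⁻ {v} {y} p with ∈-filter⁻ (touches? v) {xs = filter on-arcs? (e ∷ Eint s)} p
    ... | q , tv = tv , proj₂ (∈-filter⁻ on-arcs? {xs = e ∷ Eint s} q)

    arcs-at⁺ : ∀ {v y} → y ∈ (e ∷ Eint s) → Touches v y → y ∈ᵤ arcs → y ∈ arcs-at v
    arcs-at⁺ {v} p tv c = ∈-filter⁺ (touches? v) (∈-filter⁺ on-arcs? p c) tv

    arc∈arcs-at : ∀ {v} i → Touches v (arc i) → Any (SameEdge (arc i)) (arcs-at v)
    arc∈arcs-at {v} i tv with find (cyc i)
    ... | y , y∈ , sm = ∈ᵤ-resp sm (∈⇒∈ᵤ (arcs-at⁺ y∈ (touches-resp (sameEdge-sym sm) tv) (∈ᵤ-resp (sameEdge-sym sm) (arc∈arcs i))))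

    -- Each node of the cycle meets exactly two of its edges, all others none.
    cycle-degree-even : ∀ v → 2 ∣ length (arcs-at v)
    cycle-degree-even v with on-cycle? v
    ... | no nc = subst (2 ∣_) (sym (n≤0⇒n≡0 (length-≤-of-distinct-cover sameEdge-sym sameEdge-trans (arcs-at v) [] (arcs-at-distinct v) h))) (2 ∣0)
      where
      h : ∀ {y} → y ∈ arcs-at v → Any (SameEdge y) []
      h p with arcs-at⁻ p
      ... | tv , c with on-arcs⇒ c
      ...   | i , sm with touches-resp (sameEdge-sym sm) tv
      ...     | inj₁ e1 = ⊥-elim (nc (i , e1))
      ...     | inj₂ e2 = ⊥-elim (nc (nxt i , e2))
    ... | yes (i₀ , refl) = subst (2 ∣_) (≤-antisym (length-≤-of-distinct-cover sameEdge-sym sameEdge-trans two (arcs-at v) ndTwo h2)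
                                                (length-≤-of-distinct-cover sameEdge-sym sameEdge-trans (arcs-at v) two (arcs-at-distinct v) h1)) ∣-refl
      where
      two : List (Edge n)
      two = arc i₀ ∷ arc (prv i₀) ∷ []
      ns : ¬ SameEdge (arc i₀) (arc (prv i₀))
      ns (inj₁ (a1 , _)) = nxt-irreflexive (≤-trans (s≤s z≤n) m2) i₀ (trans (cong nxt (C-injective a1)) (nxt-prv i₀))
      ns (inj₂ (_ , b1)) = nxt²-irreflexive m2 i₀ (trans (cong nxt (C-injective b1)) (nxt-prv i₀))
      ndTwo : Distinct two
      ndTwo = (ns ∷ []) ∷ [] ∷ []
      h1 : ∀ {y} → y ∈ arcs-at v → Any (SameEdge y) two
      h1 p with arcs-at⁻ p
      ... | tv , c with on-arcs⇒ c
      ...   | i , sm with touches-resp (sameEdge-sym sm) tv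
      ...     | inj₁ e1 with C-injective e1
      ...       | refl = here sm
      h1 p | tv , c | i , sm | inj₂ e2 with C-injective e2
      ...       | eq = there (here (subst (λ z → SameEdge _ (arc z)) (trans (sym (prv-nxt i)) (cong prv eq)) sm))
      h2 : ∀ {y} → y ∈ two → Any (SameEdge y) (arcs-at v)
      h2 (here refl) = arc∈arcs-at i₀ (inj₁ refl)
      h2 (there (here refl)) = arc∈arcs-at (prv i₀) (inj₂ (cong C (nxt-prv i₀)))

    even-degree′ : ∀ v → 2 ∣ degree v Eint′ + degree v rest′
    even-degree′ v = ∣m+n∣m⇒∣n (subst (2 ∣_) split (subst (2 ∣_) (sym (degree-shift v)) (even-degree v))) (cycle-degree-even v)
      where
      split : degree v (e ∷ Eint s) + degree v rest′ ≡ length (arcs-at v) + (degree v Eint′ + degree v rest′)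
      split = trans (cong (_+ degree v rest′) (length-filter-split (touches? v) on-arcs? (e ∷ Eint s)))
                    (+-assoc (length (arcs-at v)) (degree v Eint′) (degree v rest′))

    R′-oriented : ∀ x → R s′ x → ¬ R s′ (swap x)
    R′-oriented x rx ry with R′-cases rx | R′-cases ry
    ... | inj₁ r | inj₁ r′ = R-oriented x r r′
    ... | inj₁ r | inj₂ (i , eq) = fresh-arcs-unoutput i (subst (SameEdge x) eq sameEdge-swap) r
    ... | inj₂ (i , refl) | inj₁ r′ = fresh-arcs-unoutput i (sameEdge-sym sameEdge-swap) r′
    ... | inj₂ (i , refl) | inj₂ (i′ , eq) = swap-arc≢arc i i′ eq

    covered-by-step : ∀ x → x ∈ᵤ (e ∷ Eint s) → (R s′ x ⊎ R s′ (swap x)) ⊎ (x ∈ᵤ Eint′ ⊎ x ∈ᵤ rest′)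
    covered-by-step x p with on-arcs? x
    ... | yes c with on-arcs⇒ c
    ...   | i , inj₁ (refl , refl) = inj₁ (inj₁ (R′-arc fresh-arcs i))
    ...   | i , inj₂ (refl , refl) = inj₁ (inj₂ (R′-arc fresh-arcs i))
    covered-by-step x p | no nc with find p
    ... | y , y∈ , sm = inj₂ (inj₁ (∈ᵤ-resp sm (∈⇒∈ᵤ (Eint′⁺ y∈ (λ c → nc (∈ᵤ-resp sm c))))))

    S-covered′ : ∀ x → x ∈ᵤ S → (R s′ x ⊎ R s′ (swap x)) ⊎ (x ∈ᵤ Eint′ ⊎ x ∈ᵤ rest′)
    S-covered′ x p with S-covered x p
    ... | inj₁ (inj₁ r) = inj₁ (inj₁ (R′-old r))
    ... | inj₁ (inj₂ r) = inj₁ (inj₂ (R′-old r))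
    ... | inj₂ (inj₁ q) = covered-by-step x (there q)
    ... | inj₂ (inj₂ (here sm)) = covered-by-step x (here sm)
    ... | inj₂ (inj₂ (there q)) = inj₂ (inj₂ q)

    R′⊆S : ∀ x → R s′ x → x ∈ᵤ S
    R′⊆S x r with R′-cases r
    ... | inj₁ r0 = R⊆S x r0
    ... | inj₂ (i , refl) = Eint+⊆S (arc i) (cyc i)

    R′∉Eint′ : ∀ x → R s′ x → ¬ x ∈ᵤ Eint′
    R′∉Eint′ x r p with R′-cases r
    ... | inj₁ r0 = R∉Eint+ x r0 (Eint′⊆Eint+ p)
    ... | inj₂ (i , refl) with find p
    ...   | y , y∈ , sm = proj₂ (Eint′⁻ y∈) (∈ᵤ-resp (sameEdge-sym sm) (arc∈arcs i))

    R′∉rest : ∀ x → R s′ x → ¬ x ∈ᵤ rest′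
    R′∉rest x r q with R′-cases r
    ... | inj₁ r0 = R∉rest x r0 (there q)
    ... | inj₂ (i , refl) with find (cyc i)
    ...   | y , y∈ , sm = Eint+-disjoint-rest′ y y∈ (∈ᵤ-resp (sameEdge-sym sm) q)

    Eint′-acyclic : ¬ Cycle Eint′
    Eint′-acyclic (m′ , C′ , m2′ , inj′ , ed′) = Eint-acyclic (m′ , C′ , m2′ , inj′ , λ i → Eint′⊆Eint (ed′ i))

    edge-invariant′ : EdgeInvariant S s′ rest′
    edge-invariant′ = record
      { R-oriented = R′-oriented ; S-covered = S-covered′ ; R⊆S = R′⊆S ; R∉Eint = R′∉Eint′ ; R∉rest = R′∉rest
      ; Eint-distinct = AllPairs.filter⁺ (λ x → ¬? (on-arcs? x)) Eint+-distinct ; rest-distinct = AllPairs.tail rest-distinct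
      ; Eint-disjoint-rest = λ x p → Eint+-disjoint-rest′ x (proj₁ (Eint′⁻ p))
      ; Eint-loopless = All.filter⁺ (λ x → ¬? (on-arcs? x)) Eint+-loopless ; rest-loopless = All.tail rest-loopless
      ; Eint-acyclic = Eint′-acyclic ; even-degree = even-degree′
      ; Eint⊆S = λ x p → Eint+⊆S x (Eint′⊆Eint+ p) ; rest⊆S = λ x p → rest⊆S x (there p) }

module _ {n : ℕ} where
  successor-invariant-any-Eint : ∀ {s : State n} {δ} (X : List (Edge n)) →
                                 SuccessorInvariant s δ → SuccessorInvariant (record s { Eint = X }) δ
  successor-invariant-any-Eint X I = record
    { δ-written = δ-written ; δ-closed = δ-closed ; R-labelled = R-labelled ; same-label-reach = same-label-reach
    ; labelled-has-F = labelled-has-F ; F-functional = F-functional ; F-labelled = F-labelled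
    ; F-unwritten = F-unwritten ; label≤c = label≤c ; c≤#labelled = c≤#labelled }
    where open SuccessorInvariant I

  successor-invariant-init : SuccessorInvariant (initState {n}) (λ x → x)
  successor-invariant-init = record
    { δ-written = λ u v r () ; δ-closed = λ x () ; R-labelled = λ u v () ; same-label-reach = λ x y ()
    ; labelled-has-F = λ v () ; F-functional = λ u u′ v () ; F-labelled = λ u v ()
    ; F-unwritten = λ u v r () ; label≤c = λ v → z≤n ; c≤#labelled = z≤n }

  run-invariants : ∀ {S : List (Edge n)} {s sf : State n} {rest} → Run s rest sf → EdgeInvariant S s rest →
                   (Σ (Edge n → Edge n) λ δ → SuccessorInvariant s δ) →
                   Σ (Edge n → Edge n) λ δ → SuccessorInvariant sf δ × EdgeInvariant S sf []
  run-invariants done EI (δ , I) = δ , I , EI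
  run-invariants {s = s} (step (no-cycle {e = e} acyclic) run) EI (δ , I) =
    run-invariants run (edge-invariant-no-cycle EI acyclic) (δ , successor-invariant-any-Eint (e ∷ Eint s) I)
  run-invariants {s = s} (step (merge {e = e} m C Js 2≤m C-injective on-cycle valid) run) EI (δ , I) =
    run-invariants run (MergeEdges.edge-invariant′ EI m C Js 2≤m C-injective on-cycle valid)
      (Merge.δ′ s₊ m C Js C-injective valid δ I₊ ,
       Merge.Fresh.successor-invariant′ s₊ m C Js C-injective valid δ I₊ (MergeEdges.fresh-arcs EI m C Js 2≤m C-injective on-cycle valid))
    where
    s₊ : State n
    s₊ = record s { Eint = e ∷ Eint s }
    I₊ : SuccessorInvariant s₊ δ
    I₊ = successor-invariant-any-Eint (e ∷ Eint s) I

  RStar? : (T : List (Triple n)) → Decidable (RStar T)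
  RStar? [] x = no λ ()
  RStar? ((a , b , r) ∷ T) x with (a , b) ≟e x | RStar? T x
  ... | yes refl | _ = yes (r , here refl)
  ... | no _ | yes (r′ , p) = yes (r′ , there p)
  ... | no ab≢x | no ¬R = no λ { (_ , here refl) → ab≢x refl ; (r′ , there p) → ¬R (r′ , p) }

  stepsOf-endpoints : ∀ w ws {z : Edge n} → z ∈ stepsOf w ws → proj₁ z ∈ (w ∷ ws) × proj₂ z ∈ (w ∷ ws)
  stepsOf-endpoints w (w₁ ∷ ws) (here refl) = here refl , there (here refl)
  stepsOf-endpoints w (w₁ ∷ ws) (there p) with a , b ← stepsOf-endpoints w₁ ws p = there a , there b

  walk-constant : ∀ {A : Set} (f : Fin n → A) w ws → All (λ z → f (proj₁ z) ≡ f (proj₂ z)) (stepsOf w ws) →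
                  ∀ {u} → u ∈ (w ∷ ws) → f u ≡ f w
  walk-constant f w ws _ (here refl) = refl
  walk-constant f w (w₁ ∷ ws) (eq ∷ const) (there p) = trans (walk-constant f w₁ ws const p) (sym eq)

  stepsOf-applyUpTo : ∀ N (a : ℕ → Edge n) → (∀ i → proj₁ (a (suc i)) ≡ proj₂ (a i)) →
                      stepsOf (proj₁ (a 0)) (applyUpTo (λ i → proj₁ (a (suc i))) N) ≡ applyUpTo a N
  stepsOf-applyUpTo zero a _ = refl
  stepsOf-applyUpTo (suc N) a chained =
    cong₂ _∷_ (cong (proj₁ (a 0) ,_) (chained 0)) (stepsOf-applyUpTo N (λ i → a (suc i)) (λ i → chained (suc i)))

  lastOf-applyUpTo : ∀ N (a : ℕ → Edge n) → lastOf (proj₁ (a 0)) (applyUpTo (λ i → proj₁ (a (suc i))) N) ≡ proj₁ (a N)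
  lastOf-applyUpTo zero a = refl
  lastOf-applyUpTo (suc N) a = lastOf-applyUpTo N (λ i → a (suc i))

module FinalState {n : ℕ} (S : List (Edge n)) (simple : SimpleStream S) (eulerian : Eulerian S)
                  (sf : State n) (run : Run initState S sf) where

  private
    invariants : Σ (Edge n → Edge n) λ δ → SuccessorInvariant sf δ × EdgeInvariant S sf []
    invariants = run-invariants run (edge-invariant-init S simple eulerian) ((λ x → x) , successor-invariant-init)

  δ : Edge n → Edge n
  δ = proj₁ invariants

  open SuccessorInvariant (proj₁ (proj₂ invariants)) public
  open EdgeInvariant (proj₂ (proj₂ invariants)) public

  Eint-empty : Eint sf ≡ []
  Eint-empty = acyclic-even-degree⇒empty (Eint sf) Eint-distinct Eint-loopless
                 (λ v → subst (2 ∣_) (+-identityʳ _) (even-degree v)) Eint-acyclic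

  one-orientation : ∀ x → x ∈ᵤ S → R sf x ⊎ R sf (swap x)
  one-orientation x x∈S with S-covered x x∈S
  ... | inj₁ R-or-swap = R-or-swap
  ... | inj₂ (inj₁ x∈Eint) = ⊥-elim (empty (subst (x ∈ᵤ_) Eint-empty x∈Eint))
    where empty : ¬ x ∈ᵤ []
          empty ()
  ... | inj₂ (inj₂ ())

  orientation : ∀ x → x ∈ᵤ S → (R sf x ⊎ R sf (swap x)) × ¬ (R sf x × R sf (swap x))
  orientation x x∈S = one-orientation x x∈S , λ (Rx , Rx̃) → R-oriented x Rx Rx̃

  private
    w₀ : Fin n
    w₀ = proj₁ eulerian
    ws : List (Fin n)
    ws = proj₁ (proj₂ eulerian)
    trail⊆S : All (_∈ᵤ S) (stepsOf w₀ ws)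
    trail⊆S = proj₁ (proj₂ (proj₂ (proj₂ (proj₂ eulerian))))
    S⊆trail : ∀ x → x ∈ S → x ∈ᵤ stepsOf w₀ ws
    S⊆trail = proj₂ (proj₂ (proj₂ (proj₂ (proj₂ eulerian))))

    trail-labelled : All (λ z → t sf (proj₁ z) ≡ t sf (proj₂ z)) (stepsOf w₀ ws)
    trail-labelled = All.map edge-labelled trail⊆S
      where
      edge-labelled : ∀ {z} → z ∈ᵤ S → t sf (proj₁ z) ≡ t sf (proj₂ z)
      edge-labelled {z} z∈S with one-orientation z z∈S
      ... | inj₁ Rz = proj₁ (R-labelled _ _ Rz)
      ... | inj₂ Rz̃ = sym (proj₁ (R-labelled _ _ Rz̃))

  -- S is traversed by one trail, so the final labelling is constant on it.
  R-label : ∀ {x} → R sf x → t sf (proj₂ x) ≡ t sf w₀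
  R-label {x} Rx with y , y∈S , x~y ← find (R⊆S x Rx) with z , z∈trail , y~z ← find (S⊆trail y y∈S)
    with sameEdge-trans x~y y~z | stepsOf-endpoints w₀ ws z∈trail
  ... | inj₁ (_ , refl) | _ , z₂∈ = walk-constant (t sf) w₀ ws trail-labelled z₂∈
  ... | inj₂ (_ , refl) | z₁∈ , _ = walk-constant (t sf) w₀ ws trail-labelled z₁∈

  R-connected : ∀ {x y} → R sf x → R sf y → Reach δ x y
  R-connected {x} {y} Rx Ry = same-label-reach x y Rx Ry (trans (R-label Rx) (sym (R-label Ry)))

  orient : Edge n → Edge n
  orient x with RStar? (output sf) x
  ... | yes _ = x
  ... | no _ = swap x

  orient-cases : ∀ x → (R sf x × orient x ≡ x) ⊎ (¬ R sf x × orient x ≡ swap x)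
  orient-cases x with RStar? (output sf) x
  ... | yes Rx = inj₁ (Rx , refl)
  ... | no ¬Rx = inj₂ (¬Rx , refl)

  orient-same : ∀ x → SameEdge x (orient x)
  orient-same x with orient-cases x
  ... | inj₁ (_ , eq) = subst (SameEdge x) (sym eq) sameEdge-refl
  ... | inj₂ (_ , eq) = subst (SameEdge x) (sym eq) sameEdge-swap

  oriented : List (Edge n)
  oriented = map orient S

  oriented-unique : Unique oriented
  oriented-unique = AllPairs.map⁺ (AllPairs.map distinct-orientations (proj₂ simple))
    where
    distinct-orientations : ∀ {x y} → ¬ SameEdge x y → orient x ≢ orient y
    distinct-orientations {x} {y} x≁y eq =
      x≁y (sameEdge-trans (orient-same x) (subst (λ z → SameEdge z y) (sym eq) (sameEdge-sym (orient-same y))))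

  oriented⇒R : ∀ {x} → x ∈ oriented → R sf x
  oriented⇒R x∈ with y , y∈S , refl ← ∈-map⁻ orient x∈ with orient-cases y
  ... | inj₁ (Ry , eq) = subst (R sf) (sym eq) Ry
  ... | inj₂ (¬Ry , eq) with one-orientation y (∈⇒∈ᵤ y∈S)
  ...   | inj₁ Ry = ⊥-elim (¬Ry Ry)
  ...   | inj₂ Rỹ = subst (R sf) (sym eq) Rỹ

  R⇒oriented : ∀ {x} → R sf x → x ∈ oriented
  R⇒oriented {x} Rx with y , y∈S , x~y ← find (R⊆S x Rx) with orient-cases y | x~y
  ... | inj₁ (Ry , eq) | inj₁ (refl , refl) = subst (_∈ oriented) eq (∈-map⁺ orient y∈S)
  ... | inj₁ (Ry , eq) | inj₂ (refl , refl) = ⊥-elim (R-oriented y Ry Rx)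
  ... | inj₂ (¬Ry , eq) | inj₁ (refl , refl) = ⊥-elim (¬Ry Rx)
  ... | inj₂ (¬Ry , eq) | inj₂ (refl , refl) = subst (_∈ oriented) eq (∈-map⁺ orient y∈S)

  module _ {e : Edge n} (Re : R sf e) where

    open Orbit _≟e_ δ oriented oriented-unique R⇒oriented oriented⇒R (δ-closed _) R-connected Re

    tour-edges : List (Edge n)
    tour-edges = map (λ i → iter δ i e) (upTo (length S))

    tour-nodes : List (Fin n)
    tour-nodes = map (λ i → proj₁ (iter δ (suc i) e)) (upTo (length S))

    private
      length-oriented : length oriented ≡ length S
      length-oriented = List.length-map orient S

      tour-edges-orbit : tour-edges ≡ orbit (length S)
      tour-edges-orbit = List.map-upTo (λ i → iter δ i e) (length S)

    tour-edges-unique : Unique tour-edges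
    tour-edges-unique = subst Unique (sym tour-edges-orbit) (subst (λ k → Unique (orbit k)) length-oriented orbit-unique)

    tour-edges-exact : ∀ x → (x ∈ tour-edges → R sf x) × (R sf x → x ∈ tour-edges)
    tour-edges-exact x = subst (λ L → (x ∈ L → R sf x) × (R sf x → x ∈ L)) (sym tour-edges-orbit)
                           (subst (λ k → (x ∈ orbit k → R sf x) × (R sf x → x ∈ orbit k)) length-oriented (orbit-exact x))

    tour-closes : iter δ (length S) e ≡ e
    tour-closes = subst (λ k → iter δ k e ≡ e) length-oriented orbit-closes

    -- Consecutive edges of the orbit are chained, as δ (u , v) always starts at v.
    tour-steps : stepsOf (proj₁ e) tour-nodes ≡ tour-edges
    tour-steps = begin
      stepsOf (proj₁ e) tour-nodes                                              ≡⟨ cong (stepsOf (proj₁ e)) (List.map-upTo _ (length S)) ⟩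
      stepsOf (proj₁ e) (applyUpTo (λ i → proj₁ (iter δ (suc i) e)) (length S)) ≡⟨ stepsOf-applyUpTo (length S) (λ i → iter δ i e) chained ⟩
      orbit (length S)                                                          ≡⟨ tour-edges-orbit ⟨
      tour-edges                                                                ∎
      where
      open ≡-Reasoning
      chained : ∀ i → proj₁ (iter δ (suc i) e) ≡ proj₂ (iter δ i e)
      chained i = cong proj₁ (proj₂ (δ-shape (proj₁ (proj₂ invariants)) (proj₁ (iter-in-R (proj₁ (proj₂ invariants)) i Re))))

    euler-tour : IsEulerTour (R sf) (proj₁ e) tour-nodes
    euler-tour =
      trans (cong (lastOf (proj₁ e)) (List.map-upTo _ (length S))) (trans (lastOf-applyUpTo (length S) (λ i → iter δ i e)) (cong proj₁ tour-closes)) ,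
      subst Unique (sym tour-steps) tour-edges-unique ,
      subst (All (R sf)) (sym tour-steps) (All.tabulate (λ {x} → proj₁ (tour-edges-exact x))) ,
      λ x Rx → subst (x ∈_) (sym tour-steps) (proj₂ (tour-edges-exact x) Rx)

theorem2 : ∀ {n} (S : List (Edge n)) → SimpleStream S → Eulerian S →
  ∀ (sf : State n) → Run initState S sf →
    (∀ x → x ∈ᵤ S → (RStar (output sf) x ⊎ RStar (output sf) (swap x)) ×
                     ¬ (RStar (output sf) x × RStar (output sf) (swap x))) ×
    (∀ x → RStar (output sf) x → x ∈ᵤ S) ×
    Σ (Edge n → Edge n) λ δ →
      (∀ u v s → (u , v , s) ∈ output sf →
         Σ (Fin n) λ s′ → (s ≡ just s′) × (δ (u , v) ≡ (v , s′))) ×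
      (∀ x → RStar (output sf) x → RStar (output sf) (δ x)) ×
      (∀ e → RStar (output sf) e →
         IsEulerTour (RStar (output sf)) (proj₁ e)
           (map (λ i → proj₁ (iter δ (suc i) e)) (upTo (length S))) ×
         Unique (map (λ i → iter δ i e) (upTo (length S))) ×
         (∀ x → (x ∈ map (λ i → iter δ i e) (upTo (length S)) → RStar (output sf) x) ×
                (RStar (output sf) x → x ∈ map (λ i → iter δ i e) (upTo (length S)))) ×
         (iter δ (length S) e ≡ e))
theorem2 S simple eulerian sf run =
  orientation , R⊆S , δ , δ-written , δ-closed ,
  λ e Re → euler-tour Re , tour-edges-unique Re , tour-edges-exact Re , tour-closes Re
  where open FinalState S simple eulerian sf run
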